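{- For every positive integer $n$, $$\sum_{x\in X_n} q^{\mathrm{cwt}(x)}=\frac{1}{[n+1]_q}\begin{bmatrix}2n\\ n\end{bmatrix}_q .$$
   Context: For $m\ge 1$ let $[m]=\{1,\dots,m\}$. A ball is a subset of $[m]$ of cardinality $1$ and an arc is a subset of cardinality $2$. A $(1,2)$-configuration of $[m]$ is a set of pairwise disjoint balls and arcs in $[m]$ (the empty set is allowed). It is noncrossing if it contains no two arcs $\{i_1,j_1\},\{i_2,j_2\}$ with $i_1<i_2<j_1<j_2$. $X_n$ denotes the set of all noncrossing $(1,2)$-configurations of $[n-1]$. For $$x=\{\{a_1,b_1\},\dots,\{a_\ell,b_\ell\},\{c_1\},\dots,\{c_s\}\}\in X_n,$$ where the $\{a_i,b_i\}$ are the arcs and the $\{c_j\}$ are the balls, define $$\mathrm{cwt}(x)=\sum_{i=1}^{\ell}(a_i+b_i)+2\sum_{j=1}^{s}c_j .$$ Here $[m]_q=1+q+\dots+q^{m-1}$, $[m]!_q=[m]_q[m-1]_q\cdots[1]_q$, and $\begin{bmatrix}m\\ k\end{bmatrix}_q=\frac{[m]!_q}{[k]!_q[m-k]!_q}$. -}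

module Defs where

open import Data.Nat using (ℕ; zero; suc; _+_; _*_; _∸_; _<ᵇ_; _≡ᵇ_)
open import Data.Bool using (Bool; true; false; _∧_; not)
open import Data.List using (List; []; _∷_; map; _++_; concatMap; upTo; filterᵇ; foldr)
open import Data.Bool.ListAction using (any; all)
open import Relation.Binary.PropositionalEquality using (_≡_)

-- Polynomials in q with natural-number coefficients, as coefficient
-- lists (index i = coefficient of q^i).  Equality is coefficientwise.

Poly : Set
Poly = List ℕ

coeff : Poly → ℕ → ℕ
coeff [] _ = 0
coeff (a ∷ p) zero = a
coeff (a ∷ p) (suc i) = coeff p i

infix 4 _≈P_
_≈P_ : Poly → Poly → Set
p ≈P r = ∀ i → coeff p i ≡ coeff r i

infixl 6 _⊕_
infixl 7 _⊗_

_⊕_ : Poly → Poly → Poly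
[] ⊕ r = r
(a ∷ p) ⊕ [] = a ∷ p
(a ∷ p) ⊕ (b ∷ r) = (a + b) ∷ (p ⊕ r)

scale : ℕ → Poly → Poly
scale c = map (c *_)

_⊗_ : Poly → Poly → Poly
[] ⊗ r = []
(a ∷ p) ⊗ r = scale a r ⊕ (0 ∷ (p ⊗ r))

qpow : ℕ → Poly
qpow zero = 1 ∷ []
qpow (suc k) = 0 ∷ qpow k

qint : ℕ → Poly
qint m = foldr _⊕_ [] (map qpow (upTo m))

qfact : ℕ → Poly
qfact zero = 1 ∷ []
qfact (suc m) = qint (suc m) ⊗ qfact m

-- a ball {c} or an arc {a,b} (we only ever build arcs with a < b)
data Block : Set where
  ball : ℕ → Block
  arc  : ℕ → ℕ → Block

elems : Block → List ℕ
elems (ball c) = c ∷ []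
elems (arc a b) = a ∷ b ∷ []

range1 : ℕ → List ℕ
range1 m = map suc (upTo m)

allBlocks : ℕ → List Block
allBlocks m = map ball (range1 m)
           ++ concatMap (λ b → map (λ a → arc a b) (range1 (b ∸ 1))) (range1 m)

disjointᵇ : Block → Block → Bool
disjointᵇ B C = not (any (λ x → any (λ y → x ≡ᵇ y) (elems C)) (elems B))

crossesᵇ : Block → Block → Bool
crossesᵇ (arc a1 b1) (arc a2 b2) = (a1 <ᵇ a2) ∧ ((a2 <ᵇ b1) ∧ (b1 <ᵇ b2))
crossesᵇ _ _ = false

compatibleᵇ : Block → Block → Bool
compatibleᵇ B C = disjointᵇ B C ∧ (not (crossesᵇ B C) ∧ not (crossesᵇ C B))

pairwiseOKᵇ : List Block → Bool
pairwiseOKᵇ [] = true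
pairwiseOKᵇ (B ∷ Bs) = all (compatibleᵇ B) Bs ∧ pairwiseOKᵇ Bs

sublists : {A : Set} → List A → List (List A)
sublists [] = [] ∷ []
sublists (x ∷ xs) = sublists xs ++ map (x ∷_) (sublists xs)

X : ℕ → List (List Block)
X n = filterᵇ pairwiseOKᵇ (sublists (allBlocks (n ∸ 1)))

blockWt : Block → ℕ
blockWt (ball c) = 2 * c
blockWt (arc a b) = a + b

cwt : List Block → ℕ
cwt x = foldr (λ B s → blockWt B + s) 0 x

genX : ℕ → Poly
genX n = foldr (λ x acc → qpow (cwt x) ⊕ acc) [] (X n)

-- Read [n-1] from right to left, remembering the right ends of the arcs that are still open.
-- A point j is unused or a ball (weight 1 + q^(2j)), opens an arc, or closes one; as arcs do not
-- cross, it can only close the innermost open arc. Each arc end at j contributes q^j, so the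
-- generating polynomial counts weighted Motzkin paths from height 0 to height 0. These counts
-- are differences of the ballot polynomials q^(h(h+1)/2) [2m+1, m+1+h]_q: by the two Pascal rules
-- the differences satisfy the path recurrence, the boundary at height 0 being taken care of by
-- [2m+1, m]_q = [2m+1, m+1]_q. At height 0 this gives [2n-1, n]_q - q [2n-1, n+1]_q, which
-- multiplied by [n+1]_q ([n]!_q)^2 is [2n]!_q.

{-# OPTIONS --safe #-}
module Submission where

open import Defs
open import Data.Nat using (ℕ; _≤_; _+_; _*_)
open import Data.Nat using (zero; suc; _∸_; _<_; z≤n; s≤s)
import Data.Nat.Properties as ℕ
open import Data.Nat.Tactic.RingSolver using () renaming (solve to ℕ-solve)
open import Data.List using (List; []; _∷_; map; _++_; foldr; applyUpTo)
open import Data.Product using (_,_)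
open import Data.Sum using (inj₁; inj₂)
open import Relation.Nullary using (yes; no)
open import Relation.Binary.PropositionalEquality as ≡
  using (_≡_; _≢_; refl; sym; cong; cong₂; subst; module ≡-Reasoning)
open import Relation.Binary.Bundles using (Setoid)
import Relation.Binary.Reasoning.Setoid as SetoidReasoning
open import Algebra using (CommutativeSemiring)

-- Polynomials in q

-- _≈P_ is wrapped in a record so that both sides can be inferred from a proof.
infix 4 _≋_
record _≋_ (p r : Poly) : Set where
  constructor mk≋
  field coeff-≡ : p ≈P r
open _≋_ public

≋-refl : ∀ {p} → p ≋ p
≋-refl = mk≋ λ _ → refl

≋-sym : ∀ {p r} → p ≋ r → r ≋ p
≋-sym e = mk≋ λ i → sym (coeff-≡ e i)

≋-trans : ∀ {p r s} → p ≋ r → r ≋ s → p ≋ s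
≋-trans e f = mk≋ λ i → ≡.trans (coeff-≡ e i) (coeff-≡ f i)

≡⇒≋ : ∀ {p r} → p ≡ r → p ≋ r
≡⇒≋ refl = ≋-refl

≋-setoid : Setoid _ _
≋-setoid = record
  { Carrier = Poly ; _≈_ = _≋_
  ; isEquivalence = record { refl = ≋-refl ; sym = ≋-sym ; trans = ≋-trans } }

module ≋-Reasoning = SetoidReasoning ≋-setoid

coeff-⊕ : ∀ p r i → coeff (p ⊕ r) i ≡ coeff p i + coeff r i
coeff-⊕ []      r       i       = refl
coeff-⊕ (a ∷ p) []      i       = sym (ℕ.+-identityʳ _)
coeff-⊕ (a ∷ p) (b ∷ r) zero    = refl
coeff-⊕ (a ∷ p) (b ∷ r) (suc i) = coeff-⊕ p r i

coeff-scale : ∀ a p i → coeff (scale a p) i ≡ a * coeff p i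
coeff-scale a []      i       = sym (ℕ.*-zeroʳ a)
coeff-scale a (x ∷ p) zero    = refl
coeff-scale a (x ∷ p) (suc i) = coeff-scale a p i

⊕-cong : ∀ {p p' r r'} → p ≋ p' → r ≋ r' → p ⊕ r ≋ p' ⊕ r'
⊕-cong {p} {p'} {r} {r'} e f = mk≋ λ i → begin
  coeff (p ⊕ r) i           ≡⟨ coeff-⊕ p r i ⟩
  coeff p i + coeff r i     ≡⟨ cong₂ _+_ (coeff-≡ e i) (coeff-≡ f i) ⟩
  coeff p' i + coeff r' i   ≡⟨ coeff-⊕ p' r' i ⟨
  coeff (p' ⊕ r') i         ∎
  where open ≡-Reasoning

⊕-assoc : ∀ p r s → (p ⊕ r) ⊕ s ≋ p ⊕ (r ⊕ s)
⊕-assoc p r s = mk≋ λ i → begin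
  coeff ((p ⊕ r) ⊕ s) i             ≡⟨ coeff-⊕ (p ⊕ r) s i ⟩
  coeff (p ⊕ r) i + coeff s i       ≡⟨ cong (_+ coeff s i) (coeff-⊕ p r i) ⟩
  coeff p i + coeff r i + coeff s i ≡⟨ ℕ.+-assoc (coeff p i) _ _ ⟩
  coeff p i + (coeff r i + coeff s i) ≡⟨ cong (coeff p i +_) (coeff-⊕ r s i) ⟨
  coeff p i + coeff (r ⊕ s) i       ≡⟨ coeff-⊕ p (r ⊕ s) i ⟨
  coeff (p ⊕ (r ⊕ s)) i             ∎
  where open ≡-Reasoning

⊕-comm : ∀ p r → p ⊕ r ≋ r ⊕ p
⊕-comm p r = mk≋ λ i →
  ≡.trans (coeff-⊕ p r i) (≡.trans (ℕ.+-comm (coeff p i) _) (sym (coeff-⊕ r p i)))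

⊕-identityʳ : ∀ p → p ⊕ [] ≋ p
⊕-identityʳ p = mk≋ λ i → ≡.trans (coeff-⊕ p [] i) (ℕ.+-identityʳ _)

⊕-congˡ : ∀ p {r r'} → r ≋ r' → p ⊕ r ≋ p ⊕ r'
⊕-congˡ p = ⊕-cong (≋-refl {p})

⊕-congʳ : ∀ {p p'} r → p ≋ p' → p ⊕ r ≋ p' ⊕ r
⊕-congʳ r e = ⊕-cong e (≋-refl {r})

∷-cong : ∀ {a b p r} → a ≡ b → p ≋ r → a ∷ p ≋ b ∷ r
∷-cong e f = mk≋ λ { zero → e ; (suc i) → coeff-≡ f i }

0∷[]≋[] : 0 ∷ [] ≋ []
0∷[]≋[] = mk≋ λ { zero → refl ; (suc i) → refl }

scale-cong : ∀ a {p r} → p ≋ r → scale a p ≋ scale a r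
scale-cong a {p} {r} e = mk≋ λ i →
  ≡.trans (coeff-scale a p i) (≡.trans (cong (a *_) (coeff-≡ e i)) (sym (coeff-scale a r i)))

scale-distribˡ : ∀ a p r → scale a (p ⊕ r) ≋ scale a p ⊕ scale a r
scale-distribˡ a p r = mk≋ λ i → begin
  coeff (scale a (p ⊕ r)) i               ≡⟨ coeff-scale a (p ⊕ r) i ⟩
  a * coeff (p ⊕ r) i                     ≡⟨ cong (a *_) (coeff-⊕ p r i) ⟩
  a * (coeff p i + coeff r i)             ≡⟨ ℕ.*-distribˡ-+ a (coeff p i) _ ⟩
  a * coeff p i + a * coeff r i           ≡⟨ cong₂ _+_ (coeff-scale a p i) (coeff-scale a r i) ⟨
  coeff (scale a p) i + coeff (scale a r) i ≡⟨ coeff-⊕ (scale a p) (scale a r) i ⟨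
  coeff (scale a p ⊕ scale a r) i         ∎
  where open ≡-Reasoning

scale-distribʳ : ∀ a b p → scale (a + b) p ≋ scale a p ⊕ scale b p
scale-distribʳ a b p = mk≋ λ i → begin
  coeff (scale (a + b) p) i                 ≡⟨ coeff-scale (a + b) p i ⟩
  (a + b) * coeff p i                       ≡⟨ ℕ.*-distribʳ-+ (coeff p i) a b ⟩
  a * coeff p i + b * coeff p i             ≡⟨ cong₂ _+_ (coeff-scale a p i) (coeff-scale b p i) ⟨
  coeff (scale a p) i + coeff (scale b p) i ≡⟨ coeff-⊕ (scale a p) (scale b p) i ⟨
  coeff (scale a p ⊕ scale b p) i           ∎
  where open ≡-Reasoning

scale-zero : ∀ p → scale 0 p ≋ []
scale-zero p = mk≋ (coeff-scale 0 p)

scale-one : ∀ p → scale 1 p ≋ p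
scale-one p = mk≋ λ i → ≡.trans (coeff-scale 1 p i) (ℕ.*-identityˡ _)

scale-scale : ∀ a b p → scale a (scale b p) ≋ scale (a * b) p
scale-scale a b p = mk≋ λ i →
  ≡.trans (coeff-scale a (scale b p) i) (≡.trans (cong (a *_) (coeff-scale b p i))
    (≡.trans (sym (ℕ.*-assoc a b _)) (sym (coeff-scale (a * b) p i))))

⊗-congˡ : ∀ p {r r'} → r ≋ r' → p ⊗ r ≋ p ⊗ r'
⊗-congˡ []      e = ≋-refl
⊗-congˡ (a ∷ p) e = ⊕-cong (scale-cong a e) (∷-cong refl (⊗-congˡ p e))

⊗-zeroʳ : ∀ p → p ⊗ [] ≋ []
⊗-zeroʳ []      = ≋-refl
⊗-zeroʳ (a ∷ p) = ≋-trans (∷-cong refl (⊗-zeroʳ p)) 0∷[]≋[]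

⊗-∷ʳ : ∀ p b r → p ⊗ (b ∷ r) ≋ scale b p ⊕ (0 ∷ p ⊗ r)
⊗-∷ʳ []      b r = ≋-sym 0∷[]≋[]
⊗-∷ʳ (c ∷ p) b r = ∷-cong (cong (_+ 0) (ℕ.*-comm c b)) (begin
  scale c r ⊕ p ⊗ (b ∷ r)                ≈⟨ ⊕-cong ≋-refl (⊗-∷ʳ p b r) ⟩
  scale c r ⊕ (scale b p ⊕ (0 ∷ p ⊗ r))  ≈⟨ ⊕-assoc (scale c r) (scale b p) _ ⟨
  (scale c r ⊕ scale b p) ⊕ (0 ∷ p ⊗ r)  ≈⟨ ⊕-cong (⊕-comm (scale c r) (scale b p)) ≋-refl ⟩
  (scale b p ⊕ scale c r) ⊕ (0 ∷ p ⊗ r)  ≈⟨ ⊕-assoc (scale b p) (scale c r) _ ⟩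
  scale b p ⊕ (scale c r ⊕ (0 ∷ p ⊗ r))  ∎)
  where open ≋-Reasoning

⊗-comm : ∀ p r → p ⊗ r ≋ r ⊗ p
⊗-comm []      r = ≋-sym (⊗-zeroʳ r)
⊗-comm (a ∷ p) r = ≋-trans (⊕-cong ≋-refl (∷-cong refl (⊗-comm p r))) (≋-sym (⊗-∷ʳ r a p))

⊗-cong : ∀ {p p' r r'} → p ≋ p' → r ≋ r' → p ⊗ r ≋ p' ⊗ r'
⊗-cong {p} {p'} {r} {r'} e f = begin
  p ⊗ r   ≈⟨ ⊗-comm p r ⟩
  r ⊗ p   ≈⟨ ⊗-congˡ r e ⟩
  r ⊗ p'  ≈⟨ ⊗-comm r p' ⟩
  p' ⊗ r  ≈⟨ ⊗-congˡ p' f ⟩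
  p' ⊗ r' ∎
  where open ≋-Reasoning

⊕-interchange : ∀ a b c d → (a ⊕ b) ⊕ (c ⊕ d) ≋ (a ⊕ c) ⊕ (b ⊕ d)
⊕-interchange a b c d = begin
  (a ⊕ b) ⊕ (c ⊕ d)  ≈⟨ ⊕-assoc a b (c ⊕ d) ⟩
  a ⊕ (b ⊕ (c ⊕ d))  ≈⟨ ⊕-cong (≋-refl {a}) (⊕-assoc b c d) ⟨
  a ⊕ ((b ⊕ c) ⊕ d)  ≈⟨ ⊕-cong (≋-refl {a}) (⊕-cong (⊕-comm b c) ≋-refl) ⟩
  a ⊕ ((c ⊕ b) ⊕ d)  ≈⟨ ⊕-cong (≋-refl {a}) (⊕-assoc c b d) ⟩
  a ⊕ (c ⊕ (b ⊕ d))  ≈⟨ ⊕-assoc a c (b ⊕ d) ⟨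
  (a ⊕ c) ⊕ (b ⊕ d)  ∎
  where open ≋-Reasoning

⊗-distribʳ : ∀ p r s → (p ⊕ r) ⊗ s ≋ p ⊗ s ⊕ r ⊗ s
⊗-distribʳ []      r       s = ≋-refl
⊗-distribʳ (a ∷ p) []      s = ≋-sym (⊕-identityʳ _)
⊗-distribʳ (a ∷ p) (b ∷ r) s =
  ≋-trans (⊕-cong (scale-distribʳ a b s) (∷-cong refl (⊗-distribʳ p r s)))
          (⊕-interchange (scale a s) (scale b s) (0 ∷ p ⊗ s) (0 ∷ r ⊗ s))

⊗-distribˡ : ∀ p r s → p ⊗ (r ⊕ s) ≋ p ⊗ r ⊕ p ⊗ s
⊗-distribˡ p r s =
  ≋-trans (⊗-comm p (r ⊕ s)) (≋-trans (⊗-distribʳ r s p) (⊕-cong (⊗-comm r p) (⊗-comm s p)))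

scale-⊗ : ∀ a p r → scale a p ⊗ r ≋ scale a (p ⊗ r)
scale-⊗ a []      r = ≋-refl
scale-⊗ a (x ∷ p) r =
  ≋-trans (⊕-cong (≋-sym (scale-scale a x r)) (∷-cong (sym (ℕ.*-zeroʳ a)) (scale-⊗ a p r)))
          (≋-sym (scale-distribˡ a (scale x r) (0 ∷ p ⊗ r)))

⊗-assoc : ∀ p r s → (p ⊗ r) ⊗ s ≋ p ⊗ (r ⊗ s)
⊗-assoc []      r s = ≋-refl
⊗-assoc (a ∷ p) r s =
  ≋-trans (⊗-distribʳ (scale a r) (0 ∷ p ⊗ r) s)
          (⊕-cong (scale-⊗ a r s) (⊕-cong (scale-zero s) (∷-cong refl (⊗-assoc p r s))))

one : Poly
one = 1 ∷ []

⊗-identityˡ : ∀ p → one ⊗ p ≋ p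
⊗-identityˡ p = ≋-trans (⊕-cong (scale-one p) 0∷[]≋[]) (⊕-identityʳ p)

Poly-commutativeSemiring : CommutativeSemiring _ _
Poly-commutativeSemiring = record
  { Carrier = Poly ; _≈_ = _≋_ ; _+_ = _⊕_ ; _*_ = _⊗_ ; 0# = [] ; 1# = one
  ; isCommutativeSemiring = record
    { isSemiring = record
      { isSemiringWithoutAnnihilatingZero = record
        { +-isCommutativeMonoid = record
          { isMonoid = record
            { isSemigroup = record
              { isMagma = record { isEquivalence = Setoid.isEquivalence ≋-setoid ; ∙-cong = ⊕-cong }
              ; assoc = ⊕-assoc }
            ; identity = (λ _ → ≋-refl) , ⊕-identityʳ }
          ; comm = ⊕-comm }
        ; *-cong = ⊗-cong
        ; *-assoc = ⊗-assoc
        ; *-identity = ⊗-identityˡ , λ p → ≋-trans (⊗-comm p one) (⊗-identityˡ p)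
        ; distrib = ⊗-distribˡ , λ s p r → ⊗-distribʳ p r s }
      ; zero = (λ _ → ≋-refl) , ⊗-zeroʳ }
    ; *-comm = ⊗-comm } }

open import Algebra.Solver.Ring.NaturalCoefficients.Default Poly-commutativeSemiring
  using (solve; _:+_; _:*_; _:=_; con)

q : Poly
q = qpow 1

qpow-+ : ∀ a b → qpow (a + b) ≋ qpow a ⊗ qpow b
qpow-+ zero    b = ≋-sym (⊗-identityˡ (qpow b))
qpow-+ (suc a) b = ≋-trans (∷-cong refl (qpow-+ a b)) (≋-sym (⊕-cong (scale-zero _) ≋-refl))

⊕-cancelʳ : ∀ X Y C → X ⊕ C ≋ Y ⊕ C → X ≋ Y
⊕-cancelʳ X Y C e = mk≋ λ i → ℕ.+-cancelʳ-≡ (coeff C i) _ _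
  (≡.trans (sym (coeff-⊕ X C i)) (≡.trans (coeff-≡ e i) (coeff-⊕ Y C i)))

coeff₀-⊗ : ∀ p r → coeff (p ⊗ r) 0 ≡ coeff p 0 * coeff r 0
coeff₀-⊗ []      r = refl
coeff₀-⊗ (a ∷ p) r = ≡.trans (coeff-⊕ (scale a r) _ 0) (≡.trans (ℕ.+-identityʳ _) (coeff-scale a r 0))

coeff-⊗-prefix : ∀ r {X Y} j → (∀ k → k ≤ j → coeff X k ≡ coeff Y k) → coeff (r ⊗ X) j ≡ coeff (r ⊗ Y) j
coeff-⊗-prefix []      j       h = refl
coeff-⊗-prefix (a ∷ r) {X} {Y} j h = begin
  coeff (scale a X ⊕ (0 ∷ r ⊗ X)) j               ≡⟨ coeff-⊕ (scale a X) _ j ⟩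
  coeff (scale a X) j + coeff (0 ∷ r ⊗ X) j       ≡⟨ cong₂ _+_ scaled (shifted j h) ⟩
  coeff (scale a Y) j + coeff (0 ∷ r ⊗ Y) j       ≡⟨ coeff-⊕ (scale a Y) _ j ⟨
  coeff (scale a Y ⊕ (0 ∷ r ⊗ Y)) j               ∎
  where
  open ≡-Reasoning
  scaled : coeff (scale a X) j ≡ coeff (scale a Y) j
  scaled = ≡.trans (coeff-scale a X j) (≡.trans (cong (a *_) (h j ℕ.≤-refl)) (sym (coeff-scale a Y j)))
  shifted : ∀ i → (∀ k → k ≤ i → coeff X k ≡ coeff Y k) → coeff (0 ∷ r ⊗ X) i ≡ coeff (0 ∷ r ⊗ Y) i
  shifted zero    _ = refl
  shifted (suc i) g = coeff-⊗-prefix r i (λ k k≤i → g k (ℕ.m≤n⇒m≤1+n k≤i))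

-- By strong induction on the index: coefficient i of (1 ∷ c) ⊗ X is that of X plus one that
-- only depends on the lower coefficients of X.
⊗-cancelˡ : ∀ c {X Y} → coeff c 0 ≡ 1 → c ⊗ X ≋ c ⊗ Y → X ≋ Y
⊗-cancelˡ (.1 ∷ c) {X} {Y} refl e = mk≋ λ i → agree i i ℕ.≤-refl
  where
  expand : ∀ Z i → coeff ((1 ∷ c) ⊗ Z) i ≡ coeff Z i + coeff (0 ∷ c ⊗ Z) i
  expand Z i = ≡.trans (coeff-⊕ (scale 1 Z) _ i) (cong (_+ coeff (0 ∷ c ⊗ Z) i) (coeff-≡ (scale-one Z) i))
  agree : ∀ i k → k ≤ i → coeff X k ≡ coeff Y k
  agree zero    zero z≤n = ℕ.+-cancelʳ-≡ 0 _ _ (≡.trans (sym (expand X 0)) (≡.trans (coeff-≡ e 0) (expand Y 0)))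
  agree (suc i) k k≤1+i with ℕ.m≤n⇒m<n∨m≡n k≤1+i
  ... | inj₁ (s≤s k≤i) = agree i k k≤i
  ... | inj₂ refl = ℕ.+-cancelʳ-≡ (coeff (c ⊗ X) i) _ _ (begin
    coeff X (suc i) + coeff (c ⊗ X) i  ≡⟨ expand X (suc i) ⟨
    coeff ((1 ∷ c) ⊗ X) (suc i)        ≡⟨ coeff-≡ e (suc i) ⟩
    coeff ((1 ∷ c) ⊗ Y) (suc i)        ≡⟨ expand Y (suc i) ⟩
    coeff Y (suc i) + coeff (c ⊗ Y) i  ≡⟨ cong (coeff Y (suc i) +_) (coeff-⊗-prefix c i (agree i)) ⟨
    coeff Y (suc i) + coeff (c ⊗ X) i  ∎)
    where open ≡-Reasoning

-- q-integers, q-factorials and Gaussian binomials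

qint-shifted : ∀ (f : ℕ → ℕ) k n → (∀ i → f i ≡ k + i) →
               foldr _⊕_ [] (map qpow (applyUpTo f n)) ≋ qpow k ⊗ qint n
qint-shifted f k zero    f≗k+ = ≋-sym (⊗-zeroʳ (qpow k))
qint-shifted f k (suc n) f≗k+ = begin
  qpow (f 0) ⊕ foldr _⊕_ [] (map qpow (applyUpTo (λ i → f (suc i)) n))
    ≈⟨ ⊕-cong (≡⇒≋ (cong qpow (≡.trans (f≗k+ 0) (ℕ.+-identityʳ k))))
              (qint-shifted (λ i → f (suc i)) (suc k) n (λ i → ≡.trans (f≗k+ (suc i)) (ℕ.+-suc k i))) ⟩
  qpow k ⊕ qpow (suc k) ⊗ qint n
    ≈⟨ ⊕-cong (≋-refl {qpow k}) (⊗-cong (qpow-+ 1 k) ≋-refl) ⟩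
  qpow k ⊕ (q ⊗ qpow k) ⊗ qint n
    ≈⟨ solve 3 (λ x y z → x :+ (y :* x) :* z := x :* (con 1 :+ y :* z)) ≋-refl (qpow k) q (qint n) ⟩
  qpow k ⊗ (one ⊕ q ⊗ qint n)
    ≈⟨ ⊗-congˡ (qpow k) (⊕-cong ≋-refl (qint-shifted suc 1 n (λ _ → refl))) ⟨
  qpow k ⊗ qint (suc n) ∎
  where open ≋-Reasoning

qint-suc : ∀ m → qint (suc m) ≋ one ⊕ q ⊗ qint m
qint-suc m = ⊕-congˡ one (qint-shifted suc 1 m (λ _ → refl))

qint-+ : ∀ a b → qint (a + b) ≋ qint a ⊕ qpow a ⊗ qint b
qint-+ zero    b = ≋-sym (⊗-identityˡ (qint b))
qint-+ (suc a) b = begin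
  qint (suc (a + b))
    ≈⟨ qint-suc (a + b) ⟩
  one ⊕ q ⊗ qint (a + b)
    ≈⟨ ⊕-congˡ one (⊗-congˡ q (qint-+ a b)) ⟩
  one ⊕ q ⊗ (qint a ⊕ qpow a ⊗ qint b)
    ≈⟨ solve 4 (λ x y z w → con 1 :+ x :* (y :+ z :* w) := (con 1 :+ x :* y) :+ (x :* z) :* w) ≋-refl
         q (qint a) (qpow a) (qint b) ⟩
  (one ⊕ q ⊗ qint a) ⊕ (q ⊗ qpow a) ⊗ qint b
    ≈⟨ ⊕-cong (≋-sym (qint-suc a)) (⊗-cong (≋-sym (qpow-+ 1 a)) ≋-refl) ⟩
  qint (suc a) ⊕ qpow (suc a) ⊗ qint b ∎
  where open ≋-Reasoning

qint-product : ∀ m → qint (2 + m) ⊗ qint (suc m) ≋ qint (2 + (m + m)) ⊕ q ⊗ (qint (suc m) ⊗ qint m)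
qint-product m = begin
  qint (2 + m) ⊗ I₁
    ≈⟨ ⊗-cong (≋-trans (≡⇒≋ (cong qint (ℕ.+-comm 1 (suc m)))) (qint-+ (suc m) 1)) ≋-refl ⟩
  (I₁ ⊕ s ⊗ one) ⊗ I₁
    ≈⟨ solve 2 (λ I₁ s → (I₁ :+ s :* con 1) :* I₁ := I₁ :* I₁ :+ s :* I₁) ≋-refl I₁ s ⟩
  I₁ ⊗ I₁ ⊕ s ⊗ I₁
    ≈⟨ ⊕-congʳ (s ⊗ I₁) (⊗-congˡ I₁ (qint-suc m)) ⟩
  I₁ ⊗ (one ⊕ q ⊗ qint m) ⊕ s ⊗ I₁
    ≈⟨ solve 4 (λ I₁ I₀ q s → I₁ :* (con 1 :+ q :* I₀) :+ s :* I₁ := (I₁ :+ s :* I₁) :+ q :* (I₁ :* I₀))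
         ≋-refl I₁ (qint m) q s ⟩
  (I₁ ⊕ s ⊗ I₁) ⊕ q ⊗ (I₁ ⊗ qint m)
    ≈⟨ ⊕-congʳ (q ⊗ (I₁ ⊗ qint m)) (≋-sym (qint-+ (suc m) (suc m))) ⟩
  qint (suc m + suc m) ⊕ q ⊗ (I₁ ⊗ qint m)
    ≡⟨ cong (λ n → qint (suc n) ⊕ q ⊗ (I₁ ⊗ qint m)) (ℕ.+-suc m m) ⟩
  qint (2 + (m + m)) ⊕ q ⊗ (I₁ ⊗ qint m) ∎
  where
  open ≋-Reasoning
  I₁ = qint (suc m)
  s = qpow (suc m)

coeff₀-qfact : ∀ m → coeff (qfact m) 0 ≡ 1
coeff₀-qfact zero    = refl
coeff₀-qfact (suc m) = begin
  coeff (qint (suc m) ⊗ qfact m) 0            ≡⟨ coeff₀-⊗ (qint (suc m)) (qfact m) ⟩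
  coeff (qint (suc m)) 0 * coeff (qfact m) 0  ≡⟨ cong₂ _*_ (coeff-≡ (qint-suc m) 0) (coeff₀-qfact m) ⟩
  coeff (one ⊕ q ⊗ qint m) 0 * 1              ≡⟨ cong (_* 1) (coeff-⊕ one (q ⊗ qint m) 0) ⟩
  (1 + coeff (q ⊗ qint m) 0) * 1              ≡⟨ cong (λ c → (1 + c) * 1) (coeff₀-⊗ q (qint m)) ⟩
  1                                           ∎
  where open ≡-Reasoning

coeff₀-qfact-⊗ : ∀ a b → coeff (qfact a ⊗ qfact b) 0 ≡ 1
coeff₀-qfact-⊗ a b = ≡.trans (coeff₀-⊗ (qfact a) (qfact b)) (cong₂ _*_ (coeff₀-qfact a) (coeff₀-qfact b))

qbinom : ℕ → ℕ → Poly
qbinom n       zero    = one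
qbinom zero    (suc k) = []
qbinom (suc n) (suc k) = qbinom n k ⊕ qpow (suc k) ⊗ qbinom n (suc k)

qbinom-over : ∀ {n k} → n < k → qbinom n k ≋ []
qbinom-over {zero}  {suc k} _         = ≋-refl
qbinom-over {suc n} {suc k} (s≤s n<k) =
  ≋-trans (⊕-cong (qbinom-over n<k) (⊗-congˡ (qpow (suc k)) (qbinom-over (ℕ.m≤n⇒m≤1+n n<k))))
          (⊗-zeroʳ (qpow (suc k)))

qbinom-diag : ∀ n → qbinom n n ≋ one
qbinom-diag zero    = ≋-refl
qbinom-diag (suc n) =
  ≋-trans (⊕-cong (qbinom-diag n) (⊗-congˡ (qpow (suc n)) (qbinom-over (ℕ.n<1+n n))))
          (≋-trans (⊕-congˡ one (⊗-zeroʳ (qpow (suc n)))) (⊕-identityʳ one))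

qfact-qbinom : ∀ k d → qfact k ⊗ qfact d ⊗ qbinom (k + d) k ≋ qfact (k + d)
qfact-qbinom zero    d = ≋-trans (⊗-comm (one ⊗ qfact d) one) (≋-trans (⊗-identityˡ _) (⊗-identityˡ _))
qfact-qbinom (suc k) zero rewrite ℕ.+-identityʳ k =
  ≋-trans (⊗-congˡ (qfact (suc k) ⊗ one) (qbinom-diag (suc k)))
          (≋-trans (⊗-comm _ one) (≋-trans (⊗-identityˡ _) (≋-trans (⊗-comm _ one) (⊗-identityˡ _))))
qfact-qbinom (suc k) (suc d) = begin
  qfact (suc k) ⊗ qfact (suc d) ⊗ (qbinom n k ⊕ qpow (suc k) ⊗ qbinom n (suc k))
    ≈⟨ solve 7 (λ Ik fk Id fd b b' t →
         ((Ik :* fk) :* (Id :* fd)) :* (b :+ t :* b')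
         := Ik :* ((fk :* (Id :* fd)) :* b) :+ (t :* Id) :* (((Ik :* fk) :* fd) :* b')) ≋-refl
         (qint (suc k)) (qfact k) (qint (suc d)) (qfact d) (qbinom n k) (qbinom n (suc k)) (qpow (suc k)) ⟩
  qint (suc k) ⊗ (qfact k ⊗ qfact (suc d) ⊗ qbinom n k)
    ⊕ (qpow (suc k) ⊗ qint (suc d)) ⊗ (qfact (suc k) ⊗ qfact d ⊗ qbinom n (suc k))
    ≈⟨ ⊕-cong (⊗-congˡ (qint (suc k)) (qfact-qbinom k (suc d)))
              (⊗-congˡ (qpow (suc k) ⊗ qint (suc d)) shifted) ⟩
  qint (suc k) ⊗ qfact n ⊕ (qpow (suc k) ⊗ qint (suc d)) ⊗ qfact n
    ≈⟨ ⊗-distribʳ (qint (suc k)) (qpow (suc k) ⊗ qint (suc d)) (qfact n) ⟨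
  (qint (suc k) ⊕ qpow (suc k) ⊗ qint (suc d)) ⊗ qfact n
    ≈⟨ ⊗-cong (≋-sym (qint-+ (suc k) (suc d))) ≋-refl ⟩
  qfact (suc n) ∎
  where
  open ≋-Reasoning
  n = k + suc d
  shifted : qfact (suc k) ⊗ qfact d ⊗ qbinom n (suc k) ≋ qfact n
  shifted = subst (λ m → qfact (suc k) ⊗ qfact d ⊗ qbinom m (suc k) ≋ qfact m)
                  (sym (ℕ.+-suc k d)) (qfact-qbinom (suc k) d)

qfact-qbinom-above : ∀ i e → qfact (suc i) ⊗ qfact e ⊗ qbinom (i + e) (suc i) ≋ qint e ⊗ qfact (i + e)
qfact-qbinom-above i zero =
  ≋-trans (⊗-congˡ (qfact (suc i) ⊗ one) (qbinom-over (s≤s (ℕ.≤-reflexive (ℕ.+-identityʳ i)))))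
          (⊗-zeroʳ (qfact (suc i) ⊗ one))
qfact-qbinom-above i (suc e) = begin
  qfact (suc i) ⊗ (qint (suc e) ⊗ qfact e) ⊗ qbinom (i + suc e) (suc i)
    ≈⟨ solve 4 (λ a b c d → (a :* (b :* c)) :* d := b :* ((a :* c) :* d)) ≋-refl
         (qfact (suc i)) (qint (suc e)) (qfact e) (qbinom (i + suc e) (suc i)) ⟩
  qint (suc e) ⊗ (qfact (suc i) ⊗ qfact e ⊗ qbinom (i + suc e) (suc i))
    ≈⟨ ⊗-congˡ (qint (suc e)) (subst (λ m → qfact (suc i) ⊗ qfact e ⊗ qbinom m (suc i) ≋ qfact m)
                                    (sym (ℕ.+-suc i e)) (qfact-qbinom (suc i) e)) ⟩
  qint (suc e) ⊗ qfact (i + suc e) ∎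
  where open ≋-Reasoning

-- The second Pascal rule: clear denominators with qfact-qbinom and cancel [i+1]! [e]!.
qbinom-pascal′ : ∀ i e → qbinom (suc (i + e)) (suc i) ≋ qpow e ⊗ qbinom (i + e) i ⊕ qbinom (i + e) (suc i)
qbinom-pascal′ i e = ⊗-cancelˡ c (coeff₀-qfact-⊗ (suc i) e) (begin
  c ⊗ qbinom (suc i + e) (suc i)
    ≈⟨ qfact-qbinom (suc i) e ⟩
  qint (suc i + e) ⊗ qfact (i + e)
    ≈⟨ ⊗-cong (≋-trans (≡⇒≋ (cong qint (ℕ.+-comm (suc i) e))) (qint-+ e (suc i))) ≋-refl ⟩
  (qint e ⊕ qpow e ⊗ qint (suc i)) ⊗ qfact (i + e)
    ≈⟨ solve 4 (λ Ie t Ii F → (Ie :+ t :* Ii) :* F := (t :* Ii) :* F :+ Ie :* F) ≋-refl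
         (qint e) (qpow e) (qint (suc i)) (qfact (i + e)) ⟩
  (qpow e ⊗ qint (suc i)) ⊗ qfact (i + e) ⊕ qint e ⊗ qfact (i + e)
    ≈⟨ ⊕-cong (⊗-congˡ (qpow e ⊗ qint (suc i)) (qfact-qbinom i e)) (qfact-qbinom-above i e) ⟨
  (qpow e ⊗ qint (suc i)) ⊗ (qfact i ⊗ qfact e ⊗ qbinom (i + e) i) ⊕ c ⊗ qbinom (i + e) (suc i)
    ≈⟨ ⊕-congʳ (c ⊗ qbinom (i + e) (suc i))
         (solve 5 (λ t Ii fi fe b → (t :* Ii) :* ((fi :* fe) :* b) := ((Ii :* fi) :* fe) :* (t :* b)) ≋-refl
                  (qpow e) (qint (suc i)) (qfact i) (qfact e) (qbinom (i + e) i)) ⟩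
  c ⊗ (qpow e ⊗ qbinom (i + e) i) ⊕ c ⊗ qbinom (i + e) (suc i)
    ≈⟨ ⊗-distribˡ c (qpow e ⊗ qbinom (i + e) i) (qbinom (i + e) (suc i)) ⟨
  c ⊗ (qpow e ⊗ qbinom (i + e) i ⊕ qbinom (i + e) (suc i)) ∎)
  where
  open ≋-Reasoning
  c = qfact (suc i) ⊗ qfact e

-- Scaled by q^(i+1), the second Pascal rule needs no exponent n ∸ i and holds for all n and i.
qbinom-pascal′-scaled : ∀ n i → qpow (suc i) ⊗ qbinom (suc n) (suc i)
                               ≋ qpow (suc n) ⊗ qbinom n i ⊕ qpow (suc i) ⊗ qbinom n (suc i)
qbinom-pascal′-scaled n i with i ℕ.≤? n
... | yes i≤n with e , refl ← ℕ.m≤n⇒∃[o]m+o≡n i≤n = begin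
  qpow (suc i) ⊗ qbinom (suc (i + e)) (suc i)
    ≈⟨ ⊗-congˡ (qpow (suc i)) (qbinom-pascal′ i e) ⟩
  qpow (suc i) ⊗ (qpow e ⊗ qbinom (i + e) i ⊕ qbinom (i + e) (suc i))
    ≈⟨ solve 4 (λ t u b b' → t :* (u :* b :+ b') := (t :* u) :* b :+ t :* b') ≋-refl
         (qpow (suc i)) (qpow e) (qbinom (i + e) i) (qbinom (i + e) (suc i)) ⟩
  (qpow (suc i) ⊗ qpow e) ⊗ qbinom (i + e) i ⊕ qpow (suc i) ⊗ qbinom (i + e) (suc i)
    ≈⟨ ⊕-congʳ (qpow (suc i) ⊗ qbinom (i + e) (suc i)) (⊗-cong (≋-sym (qpow-+ (suc i) e)) ≋-refl) ⟩
  qpow (suc (i + e)) ⊗ qbinom (i + e) i ⊕ qpow (suc i) ⊗ qbinom (i + e) (suc i) ∎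
  where open ≋-Reasoning
... | no i≰n = begin
  qpow (suc i) ⊗ qbinom (suc n) (suc i)
    ≈⟨ ⊗-congˡ (qpow (suc i)) (qbinom-over (s≤s n<i)) ⟩
  qpow (suc i) ⊗ []
    ≈⟨ solve 2 (λ t u → t :* con 0 := u :* con 0 :+ t :* con 0) ≋-refl (qpow (suc i)) (qpow (suc n)) ⟩
  qpow (suc n) ⊗ [] ⊕ qpow (suc i) ⊗ []
    ≈⟨ ⊕-cong (⊗-congˡ (qpow (suc n)) (qbinom-over n<i))
              (⊗-congˡ (qpow (suc i)) (qbinom-over (ℕ.m<n⇒m<1+n n<i))) ⟨
  qpow (suc n) ⊗ qbinom n i ⊕ qpow (suc i) ⊗ qbinom n (suc i) ∎
  where
  open ≋-Reasoning
  n<i = ℕ.≰⇒> i≰n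

qbinom-two-steps : ∀ {N} i e → N ≡ i + e →
  qbinom (2 + N) (2 + i) ≋ qpow e ⊗ qbinom N i ⊕ (one ⊕ qpow (suc N)) ⊗ qbinom N (suc i)
                           ⊕ qpow (2 + i) ⊗ qbinom N (2 + i)
qbinom-two-steps {N} i e refl = begin
  qbinom (suc N) (suc i) ⊕ qpow (2 + i) ⊗ qbinom (suc N) (2 + i)
    ≈⟨ ⊕-cong (qbinom-pascal′ i e) (qbinom-pascal′-scaled N (suc i)) ⟩
  (qpow e ⊗ b₀ ⊕ b₁) ⊕ (qpow (suc N) ⊗ b₁ ⊕ qpow (2 + i) ⊗ b₂)
    ≈⟨ solve 6 (λ u b₀ b₁ v w b₂ → (u :* b₀ :+ b₁) :+ (v :* b₁ :+ w :* b₂)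
                                   := u :* b₀ :+ (con 1 :+ v) :* b₁ :+ w :* b₂) ≋-refl
         (qpow e) b₀ b₁ (qpow (suc N)) (qpow (2 + i)) b₂ ⟩
  qpow e ⊗ b₀ ⊕ (one ⊕ qpow (suc N)) ⊗ b₁ ⊕ qpow (2 + i) ⊗ b₂ ∎
  where
  open ≋-Reasoning
  b₀ = qbinom N i
  b₁ = qbinom N (suc i)
  b₂ = qbinom N (2 + i)

qbinom-middle : ∀ m → qbinom (suc (m + m)) m ≋ qbinom (suc (m + m)) (suc m)
qbinom-middle m = ⊗-cancelˡ c (coeff₀-qfact-⊗ (suc m) m) (begin
  c ⊗ qbinom (suc (m + m)) m
    ≈⟨ ⊗-cong (⊗-comm (qfact (suc m)) (qfact m)) ≋-refl ⟩
  qfact m ⊗ qfact (suc m) ⊗ qbinom (suc (m + m)) m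
    ≈⟨ subst (λ n → qfact m ⊗ qfact (suc m) ⊗ qbinom n m ≋ qfact n) (ℕ.+-suc m m) (qfact-qbinom m (suc m)) ⟩
  qfact (suc (m + m))
    ≈⟨ qfact-qbinom (suc m) m ⟨
  c ⊗ qbinom (suc (m + m)) (suc m) ∎)
  where
  open ≋-Reasoning
  c = qfact (suc m) ⊗ qfact m

-- Weighted Motzkin paths

qpow-merge : ∀ a b {c} → a + b ≡ c → qpow a ⊗ qpow b ≋ qpow c
qpow-merge a b refl = ≋-sym (qpow-+ a b)

qpow-regroup : ∀ a b c d → a + b ≡ c + d → qpow a ⊗ qpow b ≋ qpow c ⊗ qpow d
qpow-regroup a b c d a+b≡c+d = ≋-trans (qpow-merge a b a+b≡c+d) (qpow-+ c d)

2+[m+m]≡2*[1+m] : ∀ m → 2 + (m + m) ≡ 2 * suc m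
2+[m+m]≡2*[1+m] m = ℕ-solve (m ∷ [])

-- A point j that is not the end of an arc is unused or a ball, of weight q^(2j).
levelStep : ℕ → Poly
levelStep j = one ⊕ qpow (2 * j)

-- Paths through the positions m, m-1, ..., 1 from height h down to height 0; a step at position j
-- weighs levelStep j if it is level and q^j if it goes up or down.
motzkin : ℕ → ℕ → Poly
motzkin zero    zero    = one
motzkin zero    (suc h) = []
motzkin (suc m) zero    = levelStep (suc m) ⊗ motzkin m 0 ⊕ qpow (suc m) ⊗ motzkin m 1
motzkin (suc m) (suc h) =
  levelStep (suc m) ⊗ motzkin m (suc h) ⊕ qpow (suc m) ⊗ (motzkin m (2 + h) ⊕ motzkin m h)

triangle : ℕ → ℕ
triangle zero    = 0
triangle (suc h) = triangle h + suc h

-- The lower index m + 1 + h, instead of the symmetric m - h, makes ballot m h vanish for h > m.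
ballot : ℕ → ℕ → Poly
ballot m h = qpow (triangle h) ⊗ qbinom (suc (m + m)) (suc (h + m))

ballot-suc-unfold : ∀ m h → ballot (suc m) h ≡ qpow (triangle h) ⊗ qbinom (2 + (suc (m + m))) (suc (h + suc m))
ballot-suc-unfold m h = cong (λ n → qpow (triangle h) ⊗ qbinom (2 + n) (suc (h + suc m))) (ℕ.+-suc m m)

ballot-suc-zero : ∀ m →
  ballot (suc m) 0 ≋ levelStep (suc m) ⊗ ballot m 0 ⊕ qpow (suc m) ⊗ (ballot m 1 ⊕ ballot m 0)
ballot-suc-zero m = begin
  ballot (suc m) 0
    ≡⟨ ballot-suc-unfold m 0 ⟩
  one ⊗ qbinom (2 + N) (2 + m)
    ≈⟨ ⊗-congˡ one (qbinom-two-steps m (suc m) (sym (ℕ.+-suc m m))) ⟩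
  one ⊗ (qpow (suc m) ⊗ qbinom N m ⊕ (one ⊕ qpow (suc N)) ⊗ b₁ ⊕ qpow (2 + m) ⊗ b₂)
    ≈⟨ ⊗-congˡ one (⊕-cong (⊕-cong (⊗-congˡ (qpow (suc m)) (qbinom-middle m))
                                    (⊗-cong (⊕-congˡ one (≡⇒≋ (cong qpow (2+[m+m]≡2*[1+m] m)))) ≋-refl))
                            (⊗-cong (≋-sym (qpow-merge (suc m) 1 (ℕ.+-comm (suc m) 1))) ≋-refl)) ⟩
  one ⊗ (qpow (suc m) ⊗ b₁ ⊕ levelStep (suc m) ⊗ b₁ ⊕ (qpow (suc m) ⊗ q) ⊗ b₂)
    ≈⟨ solve 5 (λ s v b₁ t b₂ → con 1 :* (s :* b₁ :+ (con 1 :+ v) :* b₁ :+ (s :* t) :* b₂)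
                                := (con 1 :+ v) :* (con 1 :* b₁) :+ s :* (t :* b₂ :+ con 1 :* b₁)) ≋-refl
         (qpow (suc m)) (qpow (2 * suc m)) b₁ q b₂ ⟩
  levelStep (suc m) ⊗ ballot m 0 ⊕ qpow (suc m) ⊗ (ballot m 1 ⊕ ballot m 0) ∎
  where
  open ≋-Reasoning
  N = suc (m + m)
  b₁ = qbinom N (suc m)
  b₂ = qbinom N (2 + m)

ballot-suc-≤ : ∀ h k → let m = h + k in
  ballot (suc m) (suc h)
  ≋ levelStep (suc m) ⊗ ballot m (suc h) ⊕ qpow (suc m) ⊗ (ballot m (2 + h) ⊕ ballot m h)
ballot-suc-≤ h k = begin
  ballot (suc m) (suc h)
    ≡⟨ ballot-suc-unfold m (suc h) ⟩
  t₁ ⊗ qbinom (2 + N) (suc (suc h + suc m))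
    ≡⟨ cong (λ j → t₁ ⊗ qbinom (2 + N) (2 + j)) (ℕ.+-suc h m) ⟩
  t₁ ⊗ qbinom (2 + N) (2 + i)
    ≈⟨ ⊗-congˡ t₁ (qbinom-two-steps i k N≡i+k) ⟩
  t₁ ⊗ (qpow k ⊗ b₀ ⊕ (one ⊕ qpow (suc N)) ⊗ b₁ ⊕ qpow (2 + i) ⊗ b₂)
    ≈⟨ solve 7 (λ t₁ u b₀ v b₁ w b₂ → t₁ :* (u :* b₀ :+ (con 1 :+ v) :* b₁ :+ w :* b₂)
                                     := (t₁ :* u) :* b₀ :+ (con 1 :+ v) :* (t₁ :* b₁) :+ (t₁ :* w) :* b₂) ≋-refl
         t₁ (qpow k) b₀ (qpow (suc N)) b₁ (qpow (2 + i)) b₂ ⟩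
  (t₁ ⊗ qpow k) ⊗ b₀ ⊕ (one ⊕ qpow (suc N)) ⊗ (t₁ ⊗ b₁) ⊕ (t₁ ⊗ qpow (2 + i)) ⊗ b₂
    ≈⟨ ⊕-cong (⊕-cong (⊗-cong (qpow-regroup (triangle (suc h)) k (suc m) (triangle h) (lower (triangle h))) ≋-refl)
                      (⊗-cong (⊕-congˡ one (≡⇒≋ (cong qpow (2+[m+m]≡2*[1+m] m)))) ≋-refl))
              (⊗-cong (qpow-regroup (triangle (suc h)) (2 + i) (suc m) (triangle (2 + h)) (upper (triangle h)))
                      ≋-refl) ⟩
  (s ⊗ t₀) ⊗ b₀ ⊕ levelStep (suc m) ⊗ (t₁ ⊗ b₁) ⊕ (s ⊗ t₂) ⊗ b₂
    ≈⟨ solve 7 (λ s t₀ b₀ v t₁b₁ t₂ b₂ → (s :* t₀) :* b₀ :+ (con 1 :+ v) :* t₁b₁ :+ (s :* t₂) :* b₂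
                                        := (con 1 :+ v) :* t₁b₁ :+ s :* (t₂ :* b₂ :+ t₀ :* b₀)) ≋-refl
         s t₀ b₀ (qpow (2 * suc m)) (t₁ ⊗ b₁) t₂ b₂ ⟩
  levelStep (suc m) ⊗ ballot m (suc h) ⊕ s ⊗ (ballot m (2 + h) ⊕ ballot m h) ∎
  where
  open ≋-Reasoning
  m = h + k
  N = suc (m + m)
  i = suc (h + m)
  s = qpow (suc m)
  t₀ = qpow (triangle h)
  t₁ = qpow (triangle (suc h))
  t₂ = qpow (triangle (2 + h))
  b₀ = qbinom N i
  b₁ = qbinom N (suc i)
  b₂ = qbinom N (2 + i)
  N≡i+k : suc ((h + k) + (h + k)) ≡ suc (h + (h + k)) + k
  N≡i+k = ℕ-solve (h ∷ k ∷ [])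
  lower : ∀ t → t + suc h + k ≡ suc (h + k) + t
  lower t = ℕ-solve (t ∷ h ∷ k ∷ [])
  upper : ∀ t → t + suc h + suc (suc (suc (h + (h + k)))) ≡ suc (h + k) + (t + suc h + suc (suc h))
  upper t = ℕ-solve (t ∷ h ∷ k ∷ [])

ballot-suc-> : ∀ m h → m < h →
  ballot (suc m) (suc h)
  ≋ levelStep (suc m) ⊗ ballot m (suc h) ⊕ qpow (suc m) ⊗ (ballot m (2 + h) ⊕ ballot m h)
ballot-suc-> m h m<h = begin
  ballot (suc m) (suc h)
    ≡⟨ ballot-suc-unfold m (suc h) ⟩
  t₁ ⊗ qbinom (2 + N) (suc (suc h + suc m))
    ≡⟨ cong (λ j → t₁ ⊗ qbinom (2 + N) (2 + j)) (ℕ.+-suc h m) ⟩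
  t₁ ⊗ qbinom (2 + N) (2 + suc (h + m))
    ≈⟨ ⊗-congˡ t₁ (qbinom-over (s≤s (s≤s N<i))) ⟩
  t₁ ⊗ []
    ≈⟨ solve 5 (λ t₁ a s t₂ t₀ → t₁ :* con 0 := a :* (t₁ :* con 0) :+ s :* (t₂ :* con 0 :+ t₀ :* con 0))
         ≋-refl t₁ a s t₂ t₀ ⟩
  a ⊗ (t₁ ⊗ []) ⊕ s ⊗ (t₂ ⊗ [] ⊕ t₀ ⊗ [])
    ≈⟨ ⊕-cong (⊗-congˡ a (⊗-congˡ t₁ (qbinom-over (ℕ.m<n⇒m<1+n N<i))))
              (⊗-congˡ s (⊕-cong (⊗-congˡ t₂ (qbinom-over (ℕ.m<n⇒m<1+n (ℕ.m<n⇒m<1+n N<i))))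
                                 (⊗-congˡ t₀ (qbinom-over N<i)))) ⟨
  a ⊗ ballot m (suc h) ⊕ s ⊗ (ballot m (2 + h) ⊕ ballot m h) ∎
  where
  open ≋-Reasoning
  N = suc (m + m)
  a = levelStep (suc m)
  s = qpow (suc m)
  t₀ = qpow (triangle h)
  t₁ = qpow (triangle (suc h))
  t₂ = qpow (triangle (2 + h))
  N<i : N < suc (h + m)
  N<i = s≤s (ℕ.+-monoˡ-< m m<h)

ballot-suc : ∀ m h →
  ballot (suc m) (suc h)
  ≋ levelStep (suc m) ⊗ ballot m (suc h) ⊕ qpow (suc m) ⊗ (ballot m (2 + h) ⊕ ballot m h)
ballot-suc m h with h ℕ.≤? m
... | yes h≤m with k , refl ← ℕ.m≤n⇒∃[o]m+o≡n h≤m = ballot-suc-≤ h k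
... | no h≰m = ballot-suc-> m h (ℕ.≰⇒> h≰m)

motzkin-ballot : ∀ m h → motzkin m h ⊕ ballot m (suc h) ≋ ballot m h
motzkin-ballot zero zero = begin
  one ⊕ q ⊗ qbinom 1 2  ≈⟨ ⊕-congˡ one (⊗-congˡ q (qbinom-over {1} {2} (s≤s (s≤s z≤n)))) ⟩
  one ⊕ q ⊗ []          ≈⟨ ⊕-congˡ one (⊗-zeroʳ q) ⟩
  one ⊕ []              ≈⟨ ⊕-identityʳ one ⟩
  one                   ≈⟨ ⊗-identityˡ one ⟨
  one ⊗ one             ≈⟨ ⊗-congˡ one (qbinom-diag 1) ⟨
  ballot 0 0            ∎
  where open ≋-Reasoning
motzkin-ballot zero (suc h) = ≋-trans (vanishes (suc h)) (≋-sym (vanishes h))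
  where
  vanishes : ∀ j → ballot 0 (suc j) ≋ []
  vanishes j = ≋-trans (⊗-congˡ (qpow (triangle (suc j))) (qbinom-over {1} {suc (suc j + 0)} (s≤s (s≤s z≤n))))
                       (⊗-zeroʳ (qpow (triangle (suc j))))
motzkin-ballot (suc m) zero = begin
  (a ⊗ motzkin m 0 ⊕ s ⊗ motzkin m 1) ⊕ ballot (suc m) 1
    ≈⟨ ⊕-congˡ (a ⊗ motzkin m 0 ⊕ s ⊗ motzkin m 1) (ballot-suc m 0) ⟩
  (a ⊗ motzkin m 0 ⊕ s ⊗ motzkin m 1) ⊕ (a ⊗ ballot m 1 ⊕ s ⊗ (ballot m 2 ⊕ ballot m 0))
    ≈⟨ solve 7 (λ a s M₀ M₁ Y₀ Y₁ Y₂ → (a :* M₀ :+ s :* M₁) :+ (a :* Y₁ :+ s :* (Y₂ :+ Y₀))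
                                      := a :* (M₀ :+ Y₁) :+ s :* ((M₁ :+ Y₂) :+ Y₀)) ≋-refl
         a s (motzkin m 0) (motzkin m 1) (ballot m 0) (ballot m 1) (ballot m 2) ⟩
  a ⊗ (motzkin m 0 ⊕ ballot m 1) ⊕ s ⊗ ((motzkin m 1 ⊕ ballot m 2) ⊕ ballot m 0)
    ≈⟨ ⊕-cong (⊗-congˡ a (motzkin-ballot m 0)) (⊗-congˡ s (⊕-congʳ (ballot m 0) (motzkin-ballot m 1))) ⟩
  a ⊗ ballot m 0 ⊕ s ⊗ (ballot m 1 ⊕ ballot m 0)
    ≈⟨ ballot-suc-zero m ⟨
  ballot (suc m) 0 ∎
  where
  open ≋-Reasoning
  a = levelStep (suc m)
  s = qpow (suc m)
motzkin-ballot (suc m) (suc h) = begin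
  (a ⊗ motzkin m (suc h) ⊕ s ⊗ (motzkin m (2 + h) ⊕ motzkin m h)) ⊕ ballot (suc m) (2 + h)
    ≈⟨ ⊕-congˡ (a ⊗ motzkin m (suc h) ⊕ s ⊗ (motzkin m (2 + h) ⊕ motzkin m h)) (ballot-suc m (suc h)) ⟩
  (a ⊗ motzkin m (suc h) ⊕ s ⊗ (motzkin m (2 + h) ⊕ motzkin m h))
    ⊕ (a ⊗ ballot m (2 + h) ⊕ s ⊗ (ballot m (3 + h) ⊕ ballot m (suc h)))
    ≈⟨ solve 8 (λ a s M₀ M₁ M₂ Y₁ Y₂ Y₃ → (a :* M₁ :+ s :* (M₂ :+ M₀)) :+ (a :* Y₂ :+ s :* (Y₃ :+ Y₁))
                                         := a :* (M₁ :+ Y₂) :+ s :* ((M₂ :+ Y₃) :+ (M₀ :+ Y₁))) ≋-refl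
         a s (motzkin m h) (motzkin m (suc h)) (motzkin m (2 + h))
         (ballot m (suc h)) (ballot m (2 + h)) (ballot m (3 + h)) ⟩
  a ⊗ (motzkin m (suc h) ⊕ ballot m (2 + h))
    ⊕ s ⊗ ((motzkin m (2 + h) ⊕ ballot m (3 + h)) ⊕ (motzkin m h ⊕ ballot m (suc h)))
    ≈⟨ ⊕-cong (⊗-congˡ a (motzkin-ballot m (suc h)))
              (⊗-congˡ s (⊕-cong (motzkin-ballot m (2 + h)) (motzkin-ballot m h))) ⟩
  a ⊗ ballot m (suc h) ⊕ s ⊗ (ballot m (2 + h) ⊕ ballot m h)
    ≈⟨ ballot-suc m h ⟨
  ballot (suc m) (suc h) ∎
  where
  open ≋-Reasoning
  a = levelStep (suc m)
  s = qpow (suc m)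

-- Imported only here: the constructors [] and _∷_ of All and Linked, overloaded with those
-- of List, make the polynomial algebra above very slow to check.
open import Data.Nat using (_<ᵇ_; _≡ᵇ_)
open import Data.Nat.ListAction using (sum)
open import Data.Bool using (Bool; true; false; _∧_; _∨_; not; T?)
open import Data.Bool.Properties using (∧-zeroʳ; ∧-identityʳ; ∧-assoc; ∧-comm; ∨-zeroʳ; ∨-commutativeMonoid)
open import Data.Bool.ListAction using (any; all)
open import Data.Empty using (⊥; ⊥-elim)
open import Data.Product using (_×_)
open import Data.List using (filterᵇ; length; concatMap; upTo; downFrom)
import Data.List.Properties as List
open import Data.List.Relation.Unary.All as All using (All; []; _∷_)
import Data.List.Relation.Unary.All.Properties as All
open import Data.List.Relation.Unary.Any using (here; there)
open import Data.List.Relation.Unary.Linked using (Linked; [-]; _∷_)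
open import Data.List.Relation.Unary.Linked.Properties using (Linked⇒All)
open import Data.List.Membership.Propositional using (_∈_)
open import Data.List.Relation.Binary.Permutation.Propositional
  using (_↭_; refl; prep; swap; trans; ↭-sym; ↭-trans; ↭-reflexive; module PermutationReasoning)
import Data.List.Relation.Binary.Permutation.Propositional.Properties as ↭
open import Function using (_∘_)
open import Algebra.Bundles using (CommutativeMonoid)
open import Algebra.Properties.CommutativeSemigroup (CommutativeMonoid.commutativeSemigroup ∨-commutativeMonoid)
  using () renaming (interchange to ∨-interchange)

filterᵇ-accept : ∀ {A : Set} (p : A → Bool) {x} xs → p x ≡ true → filterᵇ p (x ∷ xs) ≡ x ∷ filterᵇ p xs
filterᵇ-accept p {x} xs px with p x
... | true = refl

filterᵇ-reject : ∀ {A : Set} (p : A → Bool) {x} xs → p x ≡ false → filterᵇ p (x ∷ xs) ≡ filterᵇ p xs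
filterᵇ-reject p {x} xs ¬px with p x
... | false = refl

filterᵇ-all : ∀ {A : Set} (p : A → Bool) {xs} → All (λ x → p x ≡ true) xs → filterᵇ p xs ≡ xs
filterᵇ-all p []                  = refl
filterᵇ-all p {x ∷ xs} (px ∷ pxs) = ≡.trans (filterᵇ-accept p xs px) (cong (x ∷_) (filterᵇ-all p pxs))

filterᵇ-none : ∀ {A : Set} (p : A → Bool) {xs} → All (λ x → p x ≡ false) xs → filterᵇ p xs ≡ []
filterᵇ-none p []                    = refl
filterᵇ-none p {x ∷ xs} (¬px ∷ ¬pxs) = ≡.trans (filterᵇ-reject p xs ¬px) (filterᵇ-none p ¬pxs)

filterᵇ-cong : ∀ {A : Set} {p p′ : A → Bool} → (∀ x → p x ≡ p′ x) → ∀ xs → filterᵇ p xs ≡ filterᵇ p′ xs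
filterᵇ-cong {p = p} {p′} p≗p′ []       = refl
filterᵇ-cong {p = p} {p′} p≗p′ (x ∷ xs) with p x | p′ x | p≗p′ x
... | true  | true  | _ = cong (x ∷_) (filterᵇ-cong p≗p′ xs)
... | false | false | _ = filterᵇ-cong p≗p′ xs

filterᵇ-filterᵇ : ∀ {A : Set} (p g : A → Bool) xs →
                  filterᵇ g (filterᵇ p xs) ≡ filterᵇ (λ x → p x ∧ g x) xs
filterᵇ-filterᵇ p g []       = refl
filterᵇ-filterᵇ p g (x ∷ xs) with p x
... | false = filterᵇ-filterᵇ p g xs
... | true with g x
...   | true  = cong (x ∷_) (filterᵇ-filterᵇ p g xs)
...   | false = filterᵇ-filterᵇ p g xs

filterᵇ-comm : ∀ {A : Set} (p g : A → Bool) xs → filterᵇ g (filterᵇ p xs) ≡ filterᵇ p (filterᵇ g xs)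
filterᵇ-comm p g xs = ≡.trans (filterᵇ-filterᵇ p g xs)
  (≡.trans (filterᵇ-cong (λ x → ∧-comm (p x) (g x)) xs) (sym (filterᵇ-filterᵇ g p xs)))

filterᵇ-map : ∀ {A B : Set} (p : B → Bool) (f : A → B) xs →
              filterᵇ p (map f xs) ≡ map f (filterᵇ (λ x → p (f x)) xs)
filterᵇ-map p f []       = refl
filterᵇ-map p f (x ∷ xs) with p (f x)
... | true  = cong (f x ∷_) (filterᵇ-map p f xs)
... | false = filterᵇ-map p f xs

all-filterᵇ : ∀ {A : Set} {Q : A → Set} (f : A → Bool) {xs} →
              All (λ y → f y ≡ true → Q y) xs → All Q (filterᵇ f xs)
all-filterᵇ f []                   = []
all-filterᵇ f {y ∷ ys} (Qy ∷ Qys) with f y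
... | true  = Qy refl ∷ all-filterᵇ f Qys
... | false = all-filterᵇ f Qys

filterᵇ-all-sublists : ∀ {A : Set} (p : A → Bool) xs → filterᵇ (all p) (sublists xs) ≡ sublists (filterᵇ p xs)
filterᵇ-all-sublists p []       = refl
filterᵇ-all-sublists p (x ∷ xs) with p x in px
... | true = begin
  filterᵇ (all p) (sublists xs ++ map (x ∷_) (sublists xs))
    ≡⟨ List.filter-++ (T? ∘ all p) (sublists xs) _ ⟩
  filterᵇ (all p) (sublists xs) ++ filterᵇ (all p) (map (x ∷_) (sublists xs))
    ≡⟨ cong (filterᵇ (all p) (sublists xs) ++_) (filterᵇ-map (all p) (x ∷_) (sublists xs)) ⟩
  filterᵇ (all p) (sublists xs) ++ map (x ∷_) (filterᵇ (λ y → p x ∧ all p y) (sublists xs))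
    ≡⟨ cong (λ b → filterᵇ (all p) (sublists xs) ++ map (x ∷_) (filterᵇ (λ y → b ∧ all p y) (sublists xs)))
            px ⟩
  filterᵇ (all p) (sublists xs) ++ map (x ∷_) (filterᵇ (all p) (sublists xs))
    ≡⟨ cong (λ ys → ys ++ map (x ∷_) ys) (filterᵇ-all-sublists p xs) ⟩
  sublists (filterᵇ p xs) ++ map (x ∷_) (sublists (filterᵇ p xs)) ∎
  where open ≡-Reasoning
... | false = begin
  filterᵇ (all p) (sublists xs ++ map (x ∷_) (sublists xs))
    ≡⟨ List.filter-++ (T? ∘ all p) (sublists xs) _ ⟩
  filterᵇ (all p) (sublists xs) ++ filterᵇ (all p) (map (x ∷_) (sublists xs))
    ≡⟨ cong₂ _++_ (filterᵇ-all-sublists p xs)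
                  (filterᵇ-none (all p)
                    (All.map⁺ {f = x ∷_} (All.universal (λ y → cong (_∧ all p y) px) (sublists xs)))) ⟩
  sublists (filterᵇ p xs) ++ []
    ≡⟨ List.++-identityʳ _ ⟩
  sublists (filterᵇ p xs) ∎
  where open ≡-Reasoning

all-sublists : ∀ {A : Set} {P : A → Set} {xs} → All P xs → All (All P) (sublists xs)
all-sublists []         = [] ∷ []
all-sublists (px ∷ pxs) = All.++⁺ (all-sublists pxs) (All.map⁺ (All.map (px ∷_) (all-sublists pxs)))

any-cong : ∀ {A : Set} {f g : A → Bool} → (∀ x → f x ≡ g x) → ∀ xs → any f xs ≡ any g xs
any-cong f≗g []       = refl
any-cong f≗g (x ∷ xs) = cong₂ _∨_ (f≗g x) (any-cong f≗g xs)

any-false : ∀ {A : Set} {f : A → Bool} {xs} → All (λ x → f x ≡ false) xs → any f xs ≡ false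
any-false []         = refl
any-false (fx ∷ fxs) = cong₂ _∨_ fx (any-false fxs)

any-∨ : ∀ {A : Set} (f g : A → Bool) xs → any (λ x → f x ∨ g x) xs ≡ any f xs ∨ any g xs
any-∨ f g []       = refl
any-∨ f g (x ∷ xs) = ≡.trans (cong ((f x ∨ g x) ∨_) (any-∨ f g xs)) (∨-interchange (f x) (g x) _ _)

any-comm : ∀ {A B : Set} (R : A → B → Bool) xs ys →
           any (λ x → any (R x) ys) xs ≡ any (λ y → any (λ x → R x y) xs) ys
any-comm R []       ys = sym (any-false (All.universal (λ _ → refl) ys))
any-comm R (x ∷ xs) ys =
  ≡.trans (cong (any (R x) ys ∨_) (any-comm R xs ys)) (sym (any-∨ (R x) (λ y → any (λ x′ → R x′ y) xs) ys))

any-true : ∀ {A : Set} (f : A → Bool) {x xs} → x ∈ xs → f x ≡ true → any f xs ≡ true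
any-true f {xs = _ ∷ xs} (here refl) fx = cong (_∨ any f xs) fx
any-true f {xs = y ∷ ys} (there x∈ys) fx = ≡.trans (cong (f y ∨_) (any-true f x∈ys fx)) (∨-zeroʳ (f y))

all-false : ∀ {A : Set} (f : A → Bool) {x xs} → x ∈ xs → f x ≡ false → all f xs ≡ false
all-false f {xs = _ ∷ xs} (here refl) fx = cong (_∧ all f xs) fx
all-false f {xs = y ∷ ys} (there x∈ys) fx = ≡.trans (cong (f y ∧_) (all-false f x∈ys fx)) (∧-zeroʳ (f y))

≡ᵇ-refl : ∀ n → (n ≡ᵇ n) ≡ true
≡ᵇ-refl zero    = refl
≡ᵇ-refl (suc n) = ≡ᵇ-refl n

≡ᵇ-comm : ∀ m n → (m ≡ᵇ n) ≡ (n ≡ᵇ m)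
≡ᵇ-comm zero    zero    = refl
≡ᵇ-comm zero    (suc n) = refl
≡ᵇ-comm (suc m) zero    = refl
≡ᵇ-comm (suc m) (suc n) = ≡ᵇ-comm m n

≢⇒≡ᵇ-false : ∀ {m n} → m ≢ n → (m ≡ᵇ n) ≡ false
≢⇒≡ᵇ-false {zero}  {zero}  m≢n = ⊥-elim (m≢n refl)
≢⇒≡ᵇ-false {zero}  {suc n} _   = refl
≢⇒≡ᵇ-false {suc m} {zero}  _   = refl
≢⇒≡ᵇ-false {suc m} {suc n} m≢n = ≢⇒≡ᵇ-false (λ m≡n → m≢n (cong suc m≡n))

<⇒<ᵇ-true : ∀ {m n} → m < n → (m <ᵇ n) ≡ true
<⇒<ᵇ-true {zero}  {suc n} _         = refl
<⇒<ᵇ-true {suc m} {suc n} (s≤s m<n) = <⇒<ᵇ-true m<n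

≥⇒<ᵇ-false : ∀ {m n} → n ≤ m → (m <ᵇ n) ≡ false
≥⇒<ᵇ-false {m}     {zero}  _         = refl
≥⇒<ᵇ-false {suc m} {suc n} (s≤s n≤m) = ≥⇒<ᵇ-false n≤m

infix 4 _∈ᵇ_
_∈ᵇ_ : ℕ → Block → Bool
x ∈ᵇ B = any (x ≡ᵇ_) (elems B)

∈⇒∈ᵇ : ∀ {x} B → x ∈ elems B → (x ∈ᵇ B) ≡ true
∈⇒∈ᵇ {x} B x∈B = any-true (x ≡ᵇ_) x∈B (≡ᵇ-refl x)

∉⇒∈ᵇ : ∀ {x} B → All (x ≢_) (elems B) → (x ∈ᵇ B) ≡ false
∉⇒∈ᵇ B x∉B = any-false (All.map ≢⇒≡ᵇ-false x∉B)

disjoint-intro : ∀ B C → All (λ x → All (x ≢_) (elems C)) (elems B) → disjointᵇ B C ≡ true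
disjoint-intro B C sep = cong not (any-false (All.map (∉⇒∈ᵇ C) sep))

disjointᵇ-comm : ∀ B C → disjointᵇ B C ≡ disjointᵇ C B
disjointᵇ-comm B C = cong not (≡.trans (any-comm _≡ᵇ_ (elems B) (elems C))
  (any-cong (λ y → any-cong (λ x → ≡ᵇ-comm x y) (elems B)) (elems C)))

compatibleᵇ-comm : ∀ B C → compatibleᵇ B C ≡ compatibleᵇ C B
compatibleᵇ-comm B C = cong₂ _∧_ (disjointᵇ-comm B C) (∧-comm (not (crossesᵇ B C)) _)

compatible-intro : ∀ B C → disjointᵇ B C ≡ true → crossesᵇ B C ≡ false → crossesᵇ C B ≡ false →
                   compatibleᵇ B C ≡ true
compatible-intro B C d c c′ rewrite d | c | c′ = refl

sharing-incompatible : ∀ {x} B C → x ∈ elems B → x ∈ elems C → compatibleᵇ B C ≡ false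
sharing-incompatible B C x∈B x∈C rewrite any-true (_∈ᵇ C) x∈B (∈⇒∈ᵇ C x∈C) = refl

crossesᵇ-≥ : ∀ {a b c d} → c ≤ a → crossesᵇ (arc a b) (arc c d) ≡ false
crossesᵇ-≥ c≤a rewrite ≥⇒<ᵇ-false c≤a = refl

crossesᵇ-separated : ∀ {a b c d} → b ≤ c → crossesᵇ (arc a b) (arc c d) ≡ false
crossesᵇ-separated {a} {c = c} b≤c rewrite ≥⇒<ᵇ-false b≤c = ∧-zeroʳ (a <ᵇ c)

crossesᵇ-nested : ∀ {a b c d} → d ≤ b → crossesᵇ (arc a b) (arc c d) ≡ false
crossesᵇ-nested {a} {b} {c} d≤b rewrite ≥⇒<ᵇ-false d≤b =
  ≡.trans (cong ((a <ᵇ c) ∧_) (∧-zeroʳ (c <ᵇ b))) (∧-zeroʳ (a <ᵇ c))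

compatible-ball : ∀ x B → (x ∈ᵇ B) ≡ false → compatibleᵇ (ball x) B ≡ true
compatible-ball x (ball c)  x∉B = compatible-intro (ball x) (ball c)  (cong (λ b → not (b ∨ false)) x∉B) refl refl
compatible-ball x (arc a b) x∉B = compatible-intro (ball x) (arc a b) (cong (λ b → not (b ∨ false)) x∉B) refl refl

compatible-left : ∀ {a b} B → All (_< a) (elems B) → a < b → compatibleᵇ (arc a b) B ≡ true
compatible-left {a} {b} (ball c) (c<a ∷ []) a<b =
  compatible-intro (arc a b) (ball c)
    (disjoint-intro (arc a b) (ball c) ((ℕ.>⇒≢ c<a ∷ []) ∷ (ℕ.>⇒≢ (ℕ.<-trans c<a a<b) ∷ []) ∷ []))
    refl refl
compatible-left {a} {b} (arc c d) (c<a ∷ d<a ∷ []) a<b =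
  compatible-intro (arc a b) (arc c d)
    (disjoint-intro (arc a b) (arc c d)
      ((ℕ.>⇒≢ c<a ∷ ℕ.>⇒≢ d<a ∷ [])
       ∷ (ℕ.>⇒≢ (ℕ.<-trans c<a a<b) ∷ ℕ.>⇒≢ (ℕ.<-trans d<a a<b) ∷ []) ∷ []))
    (crossesᵇ-≥ {a} {b} {c} {d} (ℕ.<⇒≤ c<a)) (crossesᵇ-separated {c} {d} {a} {b} (ℕ.<⇒≤ d<a))

compatible-nested : ∀ {a b c d} → c < a → a < b → b < d → compatibleᵇ (arc a b) (arc c d) ≡ true
compatible-nested {a} {b} {c} {d} c<a a<b b<d =
  compatible-intro (arc a b) (arc c d)
    (disjoint-intro (arc a b) (arc c d)
      ((ℕ.>⇒≢ c<a ∷ ℕ.<⇒≢ (ℕ.<-trans a<b b<d) ∷ [])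
       ∷ (ℕ.>⇒≢ (ℕ.<-trans c<a a<b) ∷ ℕ.<⇒≢ b<d ∷ []) ∷ []))
    (crossesᵇ-≥ {a} {b} {c} {d} (ℕ.<⇒≤ c<a)) (crossesᵇ-nested {c} {d} {a} {b} (ℕ.<⇒≤ b<d))

crossed-incompatible : ∀ B C → crossesᵇ C B ≡ true → compatibleᵇ B C ≡ false
crossed-incompatible B C crossed rewrite crossed =
  ≡.trans (cong (disjointᵇ B C ∧_) (∧-zeroʳ (not (crossesᵇ B C)))) (∧-zeroʳ (disjointᵇ B C))

crossing-incompatible : ∀ {a b c d} → a < c → c < b → b < d → compatibleᵇ (arc c d) (arc a b) ≡ false
crossing-incompatible {a} {b} {c} {d} a<c c<b b<d = crossed-incompatible (arc c d) (arc a b)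
  (cong₂ _∧_ (<⇒<ᵇ-true a<c) (cong₂ _∧_ (<⇒<ᵇ-true c<b) (<⇒<ᵇ-true b<d)))

-- Generating polynomials of configurations

weight : List (List Block) → Poly
weight = foldr (λ x acc → qpow (cwt x) ⊕ acc) []

weight-++ : ∀ xs ys → weight (xs ++ ys) ≋ weight xs ⊕ weight ys
weight-++ []       ys = ≋-refl
weight-++ (x ∷ xs) ys = ≋-trans (⊕-congˡ (qpow (cwt x)) (weight-++ xs ys)) (≋-sym (⊕-assoc (qpow (cwt x)) _ _))

weight-map-∷ : ∀ B xs → weight (map (B ∷_) xs) ≋ qpow (blockWt B) ⊗ weight xs
weight-map-∷ B []       = ≋-sym (⊗-zeroʳ (qpow (blockWt B)))
weight-map-∷ B (x ∷ xs) = ≋-trans (⊕-cong (qpow-+ (blockWt B) (cwt x)) (weight-map-∷ B xs))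
                                  (≋-sym (⊗-distribˡ (qpow (blockWt B)) (qpow (cwt x)) _))

uncovered : Block → List ℕ → List ℕ
uncovered B = filterᵇ (λ r → not (r ∈ᵇ B))

uncovered-accept : ∀ B r R → (r ∈ᵇ B) ≡ false → uncovered B (r ∷ R) ≡ r ∷ uncovered B R
uncovered-accept B r R r∉B = filterᵇ-accept (λ r → not (r ∈ᵇ B)) R (cong not r∉B)

uncovered-reject : ∀ B r R → (r ∈ᵇ B) ≡ true → uncovered B (r ∷ R) ≡ uncovered B R
uncovered-reject B r R r∈B = filterᵇ-reject (λ r → not (r ∈ᵇ B)) R (cong not r∈B)

uncovered-all : ∀ B {R} → All (λ r → (r ∈ᵇ B) ≡ false) R → uncovered B R ≡ R
uncovered-all B R∉B = filterᵇ-all (λ r → not (r ∈ᵇ B)) (All.map (cong not) R∉B)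

covers : List ℕ → List Block → Bool
covers R x = all (λ r → any (r ∈ᵇ_) x) R

compatibleWith : Block → List Block → List Block
compatibleWith B = filterᵇ (compatibleᵇ B)

genCover : List ℕ → List Block → Poly
genCover R L = weight (filterᵇ (λ x → pairwiseOKᵇ x ∧ covers R x) (sublists L))

covers-∷ : ∀ R B x → covers R (B ∷ x) ≡ covers (uncovered B R) x
covers-∷ []      B x = refl
covers-∷ (r ∷ R) B x with r ∈ᵇ B
... | true  = covers-∷ R B x
... | false = cong (any (r ∈ᵇ_) x ∧_) (covers-∷ R B x)

extensions-∷ : ∀ R B L →
  filterᵇ (λ x → pairwiseOKᵇ x ∧ covers R x) (map (B ∷_) (sublists L))
  ≡ map (B ∷_) (filterᵇ (λ x → pairwiseOKᵇ x ∧ covers (uncovered B R) x) (sublists (compatibleWith B L)))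
extensions-∷ R B L = begin
  filterᵇ Q (map (B ∷_) (sublists L))
    ≡⟨ filterᵇ-map Q (B ∷_) (sublists L) ⟩
  map (B ∷_) (filterᵇ (λ x → Q (B ∷ x)) (sublists L))
    ≡⟨ cong (map (B ∷_)) (filterᵇ-cong regroup (sublists L)) ⟩
  map (B ∷_) (filterᵇ (λ x → all (compatibleᵇ B) x ∧ Q′ x) (sublists L))
    ≡⟨ cong (map (B ∷_)) (filterᵇ-filterᵇ (all (compatibleᵇ B)) Q′ (sublists L)) ⟨
  map (B ∷_) (filterᵇ Q′ (filterᵇ (all (compatibleᵇ B)) (sublists L)))
    ≡⟨ cong (map (B ∷_) ∘ filterᵇ Q′) (filterᵇ-all-sublists (compatibleᵇ B) L) ⟩
  map (B ∷_) (filterᵇ Q′ (sublists (compatibleWith B L))) ∎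
  where
  open ≡-Reasoning
  Q Q′ : List Block → Bool
  Q  x = pairwiseOKᵇ x ∧ covers R x
  Q′ x = pairwiseOKᵇ x ∧ covers (uncovered B R) x
  regroup : ∀ x → Q (B ∷ x) ≡ all (compatibleᵇ B) x ∧ Q′ x
  regroup x = ≡.trans (cong ((all (compatibleᵇ B) x ∧ pairwiseOKᵇ x) ∧_) (covers-∷ R B x))
                      (∧-assoc (all (compatibleᵇ B) x) (pairwiseOKᵇ x) _)

genCover-∷ : ∀ R B L →
  genCover R (B ∷ L) ≋ genCover R L ⊕ qpow (blockWt B) ⊗ genCover (uncovered B R) (compatibleWith B L)
genCover-∷ R B L = begin
  weight (filterᵇ Q (sublists L ++ map (B ∷_) (sublists L)))
    ≡⟨ cong weight (List.filter-++ (T? ∘ Q) (sublists L) _) ⟩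
  weight (filterᵇ Q (sublists L) ++ filterᵇ Q (map (B ∷_) (sublists L)))
    ≈⟨ weight-++ (filterᵇ Q (sublists L)) _ ⟩
  genCover R L ⊕ weight (filterᵇ Q (map (B ∷_) (sublists L)))
    ≡⟨ cong (λ xs → genCover R L ⊕ weight xs) (extensions-∷ R B L) ⟩
  genCover R L ⊕ weight (map (B ∷_) (filterᵇ Q′ (sublists (compatibleWith B L))))
    ≈⟨ ⊕-congˡ (genCover R L) (weight-map-∷ B (filterᵇ Q′ (sublists (compatibleWith B L)))) ⟩
  genCover R L ⊕ qpow (blockWt B) ⊗ genCover (uncovered B R) (compatibleWith B L) ∎
  where
  open ≋-Reasoning
  Q Q′ : List Block → Bool
  Q  x = pairwiseOKᵇ x ∧ covers R x
  Q′ x = pairwiseOKᵇ x ∧ covers (uncovered B R) x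

genCover-swap-compatible : ∀ R B C L → compatibleᵇ B C ≡ true →
                           genCover R (B ∷ C ∷ L) ≋ genCover R (C ∷ B ∷ L)
genCover-swap-compatible R B C L B~C = begin
  genCover R (B ∷ C ∷ L)
    ≈⟨ genCover-∷ R B (C ∷ L) ⟩
  genCover R (C ∷ L) ⊕ qB ⊗ genCover (uncovered B R) (compatibleWith B (C ∷ L))
    ≡⟨ cong (λ M → genCover R (C ∷ L) ⊕ qB ⊗ genCover (uncovered B R) M)
            (filterᵇ-accept (compatibleᵇ B) L B~C) ⟩
  genCover R (C ∷ L) ⊕ qB ⊗ genCover (uncovered B R) (C ∷ compatibleWith B L)
    ≈⟨ ⊕-cong (genCover-∷ R C L) (⊗-congˡ qB (genCover-∷ (uncovered B R) C (compatibleWith B L))) ⟩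
  (g₀ ⊕ qC ⊗ gC) ⊕ qB ⊗ (gB ⊕ qC ⊗ genCover (uncovered C (uncovered B R))
                                               (compatibleWith C (compatibleWith B L)))
    ≡⟨ cong₂ (λ R′ L′ → (g₀ ⊕ qC ⊗ gC) ⊕ qB ⊗ (gB ⊕ qC ⊗ genCover R′ L′))
             (filterᵇ-comm _ _ R) (filterᵇ-comm (compatibleᵇ B) (compatibleᵇ C) L) ⟩
  (g₀ ⊕ qC ⊗ gC) ⊕ qB ⊗ (gB ⊕ qC ⊗ gBC)
    ≈⟨ solve 6 (λ g₀ qB qC gB gC gBC → (g₀ :+ qC :* gC) :+ qB :* (gB :+ qC :* gBC)
                                     := (g₀ :+ qB :* gB) :+ qC :* (gC :+ qB :* gBC)) ≋-refl g₀ qB qC gB gC gBC ⟩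
  (g₀ ⊕ qB ⊗ gB) ⊕ qC ⊗ (gC ⊕ qB ⊗ gBC)
    ≈⟨ ⊕-cong (genCover-∷ R B L) (⊗-congˡ qC (genCover-∷ (uncovered C R) B (compatibleWith C L))) ⟨
  genCover R (B ∷ L) ⊕ qC ⊗ genCover (uncovered C R) (B ∷ compatibleWith C L)
    ≡⟨ cong (λ M → genCover R (B ∷ L) ⊕ qC ⊗ genCover (uncovered C R) M)
            (filterᵇ-accept (compatibleᵇ C) L (≡.trans (compatibleᵇ-comm C B) B~C)) ⟨
  genCover R (B ∷ L) ⊕ qC ⊗ genCover (uncovered C R) (compatibleWith C (B ∷ L))
    ≈⟨ genCover-∷ R C (B ∷ L) ⟨
  genCover R (C ∷ B ∷ L) ∎
  where
  open ≋-Reasoning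
  qB = qpow (blockWt B)
  qC = qpow (blockWt C)
  g₀ = genCover R L
  gB = genCover (uncovered B R) (compatibleWith B L)
  gC = genCover (uncovered C R) (compatibleWith C L)
  gBC = genCover (uncovered B (uncovered C R)) (compatibleWith B (compatibleWith C L))

genCover-swap-incompatible : ∀ R B C L → compatibleᵇ B C ≡ false →
                             genCover R (B ∷ C ∷ L) ≋ genCover R (C ∷ B ∷ L)
genCover-swap-incompatible R B C L B≁C = begin
  genCover R (B ∷ C ∷ L)
    ≈⟨ genCover-∷ R B (C ∷ L) ⟩
  genCover R (C ∷ L) ⊕ qB ⊗ genCover (uncovered B R) (compatibleWith B (C ∷ L))
    ≡⟨ cong (λ M → genCover R (C ∷ L) ⊕ qB ⊗ genCover (uncovered B R) M)
            (filterᵇ-reject (compatibleᵇ B) L B≁C) ⟩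
  genCover R (C ∷ L) ⊕ qB ⊗ gB
    ≈⟨ ⊕-congʳ (qB ⊗ gB) (genCover-∷ R C L) ⟩
  (g₀ ⊕ qC ⊗ gC) ⊕ qB ⊗ gB
    ≈⟨ solve 5 (λ g₀ qB qC gB gC → (g₀ :+ qC :* gC) :+ qB :* gB := (g₀ :+ qB :* gB) :+ qC :* gC) ≋-refl
         g₀ qB qC gB gC ⟩
  (g₀ ⊕ qB ⊗ gB) ⊕ qC ⊗ gC
    ≈⟨ ⊕-congʳ (qC ⊗ gC) (genCover-∷ R B L) ⟨
  genCover R (B ∷ L) ⊕ qC ⊗ gC
    ≡⟨ cong (λ M → genCover R (B ∷ L) ⊕ qC ⊗ genCover (uncovered C R) M)
            (filterᵇ-reject (compatibleᵇ C) L (≡.trans (compatibleᵇ-comm C B) B≁C)) ⟨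
  genCover R (B ∷ L) ⊕ qC ⊗ genCover (uncovered C R) (compatibleWith C (B ∷ L))
    ≈⟨ genCover-∷ R C (B ∷ L) ⟨
  genCover R (C ∷ B ∷ L) ∎
  where
  open ≋-Reasoning
  qB = qpow (blockWt B)
  qC = qpow (blockWt C)
  g₀ = genCover R L
  gB = genCover (uncovered B R) (compatibleWith B L)
  gC = genCover (uncovered C R) (compatibleWith C L)

genCover-swap : ∀ R B C L → genCover R (B ∷ C ∷ L) ≋ genCover R (C ∷ B ∷ L)
genCover-swap R B C L with compatibleᵇ B C in B~C
... | true  = genCover-swap-compatible R B C L B~C
... | false = genCover-swap-incompatible R B C L B~C

genCover-∷-cong : ∀ B L L′ → (∀ R → genCover R L ≋ genCover R L′) →
                  (∀ R → genCover R (compatibleWith B L) ≋ genCover R (compatibleWith B L′)) →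
                  ∀ R → genCover R (B ∷ L) ≋ genCover R (B ∷ L′)
genCover-∷-cong B L L′ same sameCompatible R =
  ≋-trans (genCover-∷ R B L)
          (≋-trans (⊕-cong (same R) (⊗-congˡ (qpow (blockWt B)) (sameCompatible (uncovered B R))))
                   (≋-sym (genCover-∷ R B L′)))

-- The filtered lists produced by genCover-∷ are not subterms of L, so the induction on the
-- permutation is nested in an induction on the length of L.
genCover-↭ : ∀ {L L′} → L ↭ L′ → ∀ R → genCover R L ≋ genCover R L′
genCover-↭ {L} σ = bounded (length L) ℕ.≤-refl σ
  where
  bounded : ∀ n {L L′} → length L ≤ n → L ↭ L′ → ∀ R → genCover R L ≋ genCover R L′
  compatible : ∀ n B {L L′} → length L ≤ n → L ↭ L′ →
               ∀ R → genCover R (compatibleWith B L) ≋ genCover R (compatibleWith B L′)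
  compatible n B {L} ℓ σ =
    bounded n (ℕ.≤-trans (List.length-filter (T? ∘ compatibleᵇ B) L) ℓ) (↭.filter-↭ (T? ∘ compatibleᵇ B) σ)
  bounded n _ refl _ = ≋-refl
  bounded (suc n) (s≤s ℓ) (prep {L} {L′} B σ) =
    genCover-∷-cong B L L′ (bounded (suc n) (ℕ.m≤n⇒m≤1+n ℓ) σ) (compatible n B ℓ σ)
  bounded (suc (suc n)) (s≤s (s≤s ℓ)) (swap {L} {L′} B C σ) R =
    ≋-trans (genCover-swap R B C L)
      (genCover-∷-cong C (B ∷ L) (B ∷ L′)
        (genCover-∷-cong B L L′ (bounded (suc (suc n)) (ℕ.m≤n⇒m≤1+n (ℕ.m≤n⇒m≤1+n ℓ)) σ)
                                (compatible n B ℓ σ))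
        (compatible (suc n) C (s≤s ℓ) (prep B σ))
        R)
  bounded n ℓ (trans σ τ) R = ≋-trans (bounded n ℓ σ R) (bounded n (subst (_≤ n) (↭.↭-length σ) ℓ) τ R)

genCover-uncoverable : ∀ {r R} L → r ∈ R → All (λ B → (r ∈ᵇ B) ≡ false) L → genCover R L ≋ []
genCover-uncoverable {r} {R} L r∈R r∉L =
  ≡⇒≋ (cong weight (filterᵇ-none _ (All.map misses-r (all-sublists r∉L))))
  where
  misses-r : ∀ {x} → All (λ B → (r ∈ᵇ B) ≡ false) x → (pairwiseOKᵇ x ∧ covers R x) ≡ false
  misses-r {x} r∉x = ≡.trans (cong (pairwiseOKᵇ x ∧_) (all-false (λ r → any (r ∈ᵇ_) x) r∈R (any-false r∉x)))
                             (∧-zeroʳ (pairwiseOKᵇ x))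

branches : List ℕ → List Block → List Block → Poly
branches R Ds L = foldr (λ D acc → qpow (blockWt D) ⊗ genCover (uncovered D R) (compatibleWith D L) ⊕ acc) [] Ds

branches-++ : ∀ R Ds Es L → branches R (Ds ++ Es) L ≋ branches R Ds L ⊕ branches R Es L
branches-++ R []       Es L = ≋-refl
branches-++ R (D ∷ Ds) Es L =
  ≋-trans (⊕-congˡ t (branches-++ R Ds Es L)) (≋-sym (⊕-assoc t (branches R Ds L) (branches R Es L)))
  where t = qpow (blockWt D) ⊗ genCover (uncovered D R) (compatibleWith D L)

branches-cong : ∀ R R′ Ds L → All (λ D → uncovered D R ≡ uncovered D R′) Ds →
                branches R Ds L ≡ branches R′ Ds L
branches-cong R R′ []       L []         = refl
branches-cong R R′ (D ∷ Ds) L (e ∷ es) =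
  cong₂ _⊕_ (cong (λ R″ → qpow (blockWt D) ⊗ genCover R″ (compatibleWith D L)) e) (branches-cong R R′ Ds L es)

-- Blocks sharing a point y are pairwise incompatible, so a configuration uses at most one of them.
genCover-cluster : ∀ {y} R Ds L → All (λ D → y ∈ elems D) Ds →
                   genCover R (Ds ++ L) ≋ genCover R L ⊕ branches R Ds L
genCover-cluster R []       L []           = ≋-sym (⊕-identityʳ (genCover R L))
genCover-cluster R (D ∷ Ds) L (y∈D ∷ y∈Ds) = begin
  genCover R (D ∷ Ds ++ L)
    ≈⟨ genCover-∷ R D (Ds ++ L) ⟩
  genCover R (Ds ++ L) ⊕ qD ⊗ genCover (uncovered D R) (compatibleWith D (Ds ++ L))
    ≡⟨ cong (λ M → genCover R (Ds ++ L) ⊕ qD ⊗ genCover (uncovered D R) M) skips-cluster ⟩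
  genCover R (Ds ++ L) ⊕ t
    ≈⟨ ⊕-congʳ t (genCover-cluster R Ds L y∈Ds) ⟩
  (genCover R L ⊕ branches R Ds L) ⊕ t
    ≈⟨ solve 3 (λ g b t → (g :+ b) :+ t := g :+ (t :+ b)) ≋-refl (genCover R L) (branches R Ds L) t ⟩
  genCover R L ⊕ (t ⊕ branches R Ds L) ∎
  where
  open ≋-Reasoning
  qD = qpow (blockWt D)
  t = qD ⊗ genCover (uncovered D R) (compatibleWith D L)
  skips-cluster : compatibleWith D (Ds ++ L) ≡ compatibleWith D L
  skips-cluster = ≡.trans (List.filter-++ (T? ∘ compatibleᵇ D) Ds L)
    (cong (_++ compatibleWith D L)
          (filterᵇ-none (compatibleᵇ D) (All.map (sharing-incompatible D _ y∈D) y∈Ds)))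

-- Transfer matrix

points : ℕ → List ℕ
points k = map suc (downFrom k)

arcsTo : ℕ → ℕ → List Block
arcsTo k p = map (λ a → arc a p) (points k)

blocksUpTo : ℕ → List Block
blocksUpTo zero    = []
blocksUpTo (suc k) = ball (suc k) ∷ (arcsTo k (suc k) ++ blocksUpTo k)

arcsInto : ℕ → List ℕ → List Block
arcsInto k = concatMap (arcsTo k)

partialBlocks : ℕ → List ℕ → List Block
partialBlocks k P = blocksUpTo k ++ arcsInto k P

-- Configurations of [k] together with one arc from [k] to each point of P: the state after
-- reading the points to the right of k, P holding the right ends of the arcs still open.
partialGen : ℕ → List ℕ → Poly
partialGen k P = genCover P (partialBlocks k P)

ArcOver : ℕ → ℕ → Block → Set
ArcOver k t (ball _)  = ⊥
ArcOver k t (arc a p) = a ≤ k × t < p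

points-≤ : ∀ k → All (_≤ k) (points k)
points-≤ zero    = []
points-≤ (suc k) = ℕ.≤-refl ∷ All.map ℕ.m≤n⇒m≤1+n (points-≤ k)

arcsTo-∋ : ∀ k p → All (λ B → p ∈ elems B) (arcsTo k p)
arcsTo-∋ k p = All.map⁺ (All.universal (λ _ → there (here refl)) (points k))

arcsTo-over : ∀ k {t p} → t < p → All (ArcOver k t) (arcsTo k p)
arcsTo-over k t<p = All.map⁺ (All.map (_, t<p) (points-≤ k))

arcsInto-over : ∀ k {t P} → All (t <_) P → All (ArcOver k t) (arcsInto k P)
arcsInto-over k []           = []
arcsInto-over k (t<p ∷ t<P) = All.++⁺ (arcsTo-over k t<p) (arcsInto-over k t<P)

blocksUpTo-below : ∀ k → All (λ B → All (_≤ k) (elems B)) (blocksUpTo k)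
blocksUpTo-below zero    = []
blocksUpTo-below (suc k) =
  (ℕ.≤-refl ∷ [])
  ∷ All.++⁺ (All.map⁺ (All.map (λ a≤k → ℕ.m≤n⇒m≤1+n a≤k ∷ ℕ.≤-refl ∷ []) (points-≤ k)))
            (All.map (All.map ℕ.m≤n⇒m≤1+n) (blocksUpTo-below k))

avoids-below : ∀ {x k} B → k < x → All (_≤ k) (elems B) → (x ∈ᵇ B) ≡ false
avoids-below B k<x below = ∉⇒∈ᵇ B (All.map (λ y≤k → ℕ.>⇒≢ (ℕ.≤-<-trans y≤k k<x)) below)

avoids-over : ∀ {x k} B → k < x → ArcOver k x B → (x ∈ᵇ B) ≡ false
avoids-over (arc a p) k<x (a≤k , x<p) =
  ∉⇒∈ᵇ (arc a p) (ℕ.>⇒≢ (ℕ.≤-<-trans a≤k k<x) ∷ ℕ.<⇒≢ x<p ∷ [])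

partialBlocks-avoid : ∀ k {x P} → k < x → All (x <_) P →
                      All (λ B → (x ∈ᵇ B) ≡ false) (partialBlocks k P)
partialBlocks-avoid k k<x x<P =
  All.++⁺ (All.map (λ {B} → avoids-below B k<x) (blocksUpTo-below k))
          (All.map (λ {B} → avoids-over B k<x) (arcsInto-over k x<P))

linked⇒all : ∀ {t P} → Linked _<_ (t ∷ P) → All (t <_) P
linked⇒all [-]            = []
linked⇒all (t<p ∷ linked) = Linked⇒All ℕ.<-trans t<p linked

linked-lower : ∀ {t u P} → t ≤ u → Linked _<_ (u ∷ P) → Linked _<_ (t ∷ P)
linked-lower t≤u [-]            = [-]
linked-lower t≤u (u<p ∷ linked) = ℕ.≤-<-trans t≤u u<p ∷ linked

transfer-open : ∀ k P → All (suc k <_) P →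
                branches P (arcsTo k (suc k)) (partialBlocks k P) ≋ partialGen k (suc k ∷ P)
transfer-open k P x<P = ≋-sym (begin
  genCover (x ∷ P) (blocksUpTo k ++ (arcsTo k x ++ arcsInto k P))
    ≈⟨ genCover-↭ (↭.shifts (blocksUpTo k) (arcsTo k x)) (x ∷ P) ⟩
  genCover (x ∷ P) (arcsTo k x ++ partialBlocks k P)
    ≈⟨ genCover-cluster (x ∷ P) (arcsTo k x) (partialBlocks k P) (arcsTo-∋ k x) ⟩
  genCover (x ∷ P) (partialBlocks k P) ⊕ branches (x ∷ P) (arcsTo k x) (partialBlocks k P)
    ≈⟨ ⊕-congʳ (branches (x ∷ P) (arcsTo k x) (partialBlocks k P))
         (genCover-uncoverable {x} {x ∷ P} (partialBlocks k P) (here refl) (partialBlocks-avoid k (ℕ.n<1+n k) x<P)) ⟩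
  branches (x ∷ P) (arcsTo k x) (partialBlocks k P)
    ≡⟨ branches-cong (x ∷ P) P (arcsTo k x) (partialBlocks k P)
         (All.map⁺ (All.universal (λ a → uncovered-reject (arc a x) x P (∈⇒∈ᵇ (arc a x) (there (here refl))))
                                  (points k))) ⟩
  branches P (arcsTo k x) (partialBlocks k P) ∎)
  where
  open ≋-Reasoning
  x = suc k

closing : ℕ → List ℕ → Poly
closing k []      = []
closing k (p ∷ P) = qpow (suc k + p) ⊗ partialGen k P

module _ (k p : ℕ) (P : List ℕ) (x<p : suc k < p) (p<P : All (p <_) P) where
  private
    x = suc k
    k<p = ℕ.<-trans (ℕ.n<1+n k) x<p

  closes-innermost-uncovered : uncovered (arc x p) (p ∷ P) ≡ P
  closes-innermost-uncovered = ≡.trans (uncovered-reject (arc x p) p P (∈⇒∈ᵇ (arc x p) (there (here refl))))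
    (uncovered-all (arc x p)
      (All.map (λ p<r → ∉⇒∈ᵇ (arc x p) (ℕ.>⇒≢ (ℕ.<-trans x<p p<r) ∷ ℕ.>⇒≢ p<r ∷ [])) p<P))

  closes-innermost-compatible : compatibleWith (arc x p) (partialBlocks k (p ∷ P)) ≡ partialBlocks k P
  closes-innermost-compatible = begin
    xp-compatible (blocksUpTo k ++ (arcsTo k p ++ arcsInto k P))
      ≡⟨ List.filter-++ (T? ∘ compatibleᵇ (arc x p)) (blocksUpTo k) _ ⟩
    xp-compatible (blocksUpTo k) ++ xp-compatible (arcsTo k p ++ arcsInto k P)
      ≡⟨ cong (xp-compatible (blocksUpTo k) ++_) (List.filter-++ (T? ∘ compatibleᵇ (arc x p)) (arcsTo k p) _) ⟩
    xp-compatible (blocksUpTo k) ++ (xp-compatible (arcsTo k p) ++ xp-compatible (arcsInto k P))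
      ≡⟨ cong₂ (λ L M → L ++ (M ++ xp-compatible (arcsInto k P)))
               (filterᵇ-all (compatibleᵇ (arc x p)) (All.map (λ {B} → left B) (blocksUpTo-below k)))
               (filterᵇ-none (compatibleᵇ (arc x p)) (All.map (sharing-incompatible (arc x p) _ (there (here refl)))
                                                              (arcsTo-∋ k p))) ⟩
    blocksUpTo k ++ xp-compatible (arcsInto k P)
      ≡⟨ cong (blocksUpTo k ++_)
              (filterᵇ-all (compatibleᵇ (arc x p)) (All.map (λ {B} → nested B) (arcsInto-over k p<P))) ⟩
    partialBlocks k P ∎
    where
    open ≡-Reasoning
    xp-compatible = compatibleWith (arc x p)
    left : ∀ B → All (_≤ k) (elems B) → compatibleᵇ (arc x p) B ≡ true
    left B below = compatible-left B (All.map s≤s below) x<p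
    nested : ∀ B → ArcOver k p B → compatibleᵇ (arc x p) B ≡ true
    nested (arc a q) (a≤k , p<q) = compatible-nested (s≤s a≤k) x<p p<q

  -- An arc from x to q > p leaves p uncovered: the only blocks containing p are arcs (a , p) with a < x,
  -- and these cross (x , q).
  closes-outer-vanish : ∀ Q → All (p <_) Q → branches (p ∷ P) (map (arc x) Q) (partialBlocks k (p ∷ P)) ≋ []
  closes-outer-vanish []      []           = ≋-refl
  closes-outer-vanish (q ∷ Q) (p<q ∷ p<Q) =
    ≋-trans (⊕-cong (⊗-congˡ (qpow (x + q)) (genCover-uncoverable _ p-uncovered p-unreachable))
                    (closes-outer-vanish Q p<Q))
            (⊗-zeroʳ (qpow (x + q)))
    where
    p-uncovered : p ∈ uncovered (arc x q) (p ∷ P)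
    p-uncovered = subst (p ∈_)
      (sym (uncovered-accept (arc x q) p P (∉⇒∈ᵇ (arc x q) (ℕ.>⇒≢ x<p ∷ ℕ.<⇒≢ p<q ∷ [])))) (here refl)
    crossed : ∀ {a} → a ≤ k → compatibleᵇ (arc x q) (arc a p) ≡ true → (p ∈ᵇ arc a p) ≡ false
    crossed a≤k compatible with () ← ≡.trans (sym compatible) (crossing-incompatible (s≤s a≤k) x<p p<q)
    p-unreachable : All (λ B → (p ∈ᵇ B) ≡ false) (compatibleWith (arc x q) (partialBlocks k (p ∷ P)))
    p-unreachable = all-filterᵇ (compatibleᵇ (arc x q)) (All.++⁺
      (All.map (λ {B} below _ → avoids-below B k<p below) (blocksUpTo-below k))
      (All.++⁺ (All.map⁺ (All.map crossed (points-≤ k)))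
               (All.map (λ {B} over _ → avoids-over B k<p over) (arcsInto-over k p<P))))

transfer-close : ∀ k P → Linked _<_ (suc k ∷ P) →
                 branches P (map (arc (suc k)) P) (partialBlocks k P) ≋ closing k P
transfer-close k []      _               = ≋-refl
transfer-close k (p ∷ P) (x<p ∷ linked) = begin
  qpow (suc k + p) ⊗ genCover (uncovered (arc (suc k) p) (p ∷ P))
                               (compatibleWith (arc (suc k) p) (partialBlocks k (p ∷ P)))
    ⊕ outer
    ≡⟨ cong₂ (λ R L → qpow (suc k + p) ⊗ genCover R L ⊕ outer)
             (closes-innermost-uncovered k p P x<p p<P) (closes-innermost-compatible k p P x<p p<P) ⟩
  closing k (p ∷ P) ⊕ outer
    ≈⟨ ⊕-congˡ (closing k (p ∷ P)) (closes-outer-vanish k p P x<p p<P P p<P) ⟩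
  closing k (p ∷ P) ⊕ []
    ≈⟨ ⊕-identityʳ (closing k (p ∷ P)) ⟩
  closing k (p ∷ P) ∎
  where
  open ≋-Reasoning
  p<P = linked⇒all linked
  outer = branches (p ∷ P) (map (arc (suc k)) P) (partialBlocks k (p ∷ P))

arcsInto-suc : ∀ k P → arcsInto (suc k) P ↭ map (arc (suc k)) P ++ arcsInto k P
arcsInto-suc k []      = refl
arcsInto-suc k (p ∷ P) = prep (arc (suc k) p)
  (↭-trans (↭.++⁺ˡ (arcsTo k p) (arcsInto-suc k P)) (↭.shifts (arcsTo k p) (map (arc (suc k)) P)))

partialBlocks-regroup : ∀ k P →
  partialBlocks (suc k) P ↭ (ball (suc k) ∷ arcsTo k (suc k) ++ map (arc (suc k)) P) ++ partialBlocks k P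
partialBlocks-regroup k P = begin
  ball x ∷ ((A ++ blocksUpTo k) ++ arcsInto x P)
    ≡⟨ cong (ball x ∷_) (List.++-assoc A (blocksUpTo k) _) ⟩
  ball x ∷ (A ++ (blocksUpTo k ++ arcsInto x P))
    ↭⟨ prep (ball x) (↭.++⁺ˡ A (↭.++⁺ˡ (blocksUpTo k) (arcsInto-suc k P))) ⟩
  ball x ∷ (A ++ (blocksUpTo k ++ (C ++ arcsInto k P)))
    ↭⟨ prep (ball x) (↭.++⁺ˡ A (↭.shifts (blocksUpTo k) C)) ⟩
  ball x ∷ (A ++ (C ++ partialBlocks k P))
    ≡⟨ cong (ball x ∷_) (List.++-assoc A C _) ⟨
  ball x ∷ ((A ++ C) ++ partialBlocks k P) ∎
  where
  open PermutationReasoning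
  x = suc k
  A = arcsTo k x
  C = map (arc x) P

transfer-step : ∀ k P → Linked _<_ (suc k ∷ P) →
  partialGen (suc k) P ≋ levelStep (suc k) ⊗ partialGen k P ⊕ (partialGen k (suc k ∷ P) ⊕ closing k P)
transfer-step k P linked = begin
  genCover P (partialBlocks (suc k) P)
    ≈⟨ genCover-↭ (partialBlocks-regroup k P) P ⟩
  genCover P (Ds ++ partialBlocks k P)
    ≈⟨ genCover-cluster P Ds (partialBlocks k P) x∈Ds ⟩
  partialGen k P ⊕ (v ⊗ genCover (uncovered (ball x) P) (compatibleWith (ball x) (partialBlocks k P)) ⊕ others)
    ≡⟨ cong₂ (λ R L → partialGen k P ⊕ (v ⊗ genCover R L ⊕ others)) ball-uncovered ball-compatible ⟩
  partialGen k P ⊕ (v ⊗ partialGen k P ⊕ others)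
    ≈⟨ solve 3 (λ g v o → g :+ (v :* g :+ o) := (con 1 :+ v) :* g :+ o) ≋-refl (partialGen k P) v others ⟩
  levelStep x ⊗ partialGen k P ⊕ others
    ≈⟨ ⊕-congˡ (levelStep x ⊗ partialGen k P)
         (≋-trans (branches-++ P (arcsTo k x) (map (arc x) P) (partialBlocks k P))
                  (⊕-cong (transfer-open k P x<P) (transfer-close k P linked))) ⟩
  levelStep x ⊗ partialGen k P ⊕ (partialGen k (x ∷ P) ⊕ closing k P) ∎
  where
  open ≋-Reasoning
  x = suc k
  v = qpow (2 * x)
  x<P = linked⇒all linked
  Ds = ball x ∷ arcsTo k x ++ map (arc x) P
  others = branches P (arcsTo k x ++ map (arc x) P) (partialBlocks k P)
  x∈Ds : All (λ D → x ∈ elems D) Ds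
  x∈Ds = here refl ∷ All.++⁺ (arcsTo-∋ k x) (All.map⁺ (All.universal (λ _ → here refl) P))
  ball-uncovered : uncovered (ball x) P ≡ P
  ball-uncovered = uncovered-all (ball x) (All.map (λ x<r → ∉⇒∈ᵇ (ball x) (ℕ.>⇒≢ x<r ∷ [])) x<P)
  ball-compatible : compatibleWith (ball x) (partialBlocks k P) ≡ partialBlocks k P
  ball-compatible = filterᵇ-all (compatibleᵇ (ball x))
    (All.map (λ {B} → compatible-ball x B) (partialBlocks-avoid k (ℕ.n<1+n k) x<P))

arcsInto-zero : ∀ P → arcsInto 0 P ≡ []
arcsInto-zero []      = refl
arcsInto-zero (p ∷ P) = arcsInto-zero P

partialGen-motzkin : ∀ k P → Linked _<_ (k ∷ P) → partialGen k P ≋ qpow (sum P) ⊗ motzkin k (length P)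
partialGen-motzkin zero    []      _ = ≋-sym (⊗-identityˡ one)
partialGen-motzkin zero    (p ∷ P) _ =
  ≋-trans (≡⇒≋ (cong (genCover (p ∷ P)) (arcsInto-zero P))) (≋-sym (⊗-zeroʳ (qpow (p + sum P))))
partialGen-motzkin (suc k) [] linked = begin
  partialGen (suc k) []
    ≈⟨ transfer-step k [] linked ⟩
  a ⊗ partialGen k [] ⊕ (partialGen k (x ∷ []) ⊕ [])
    ≈⟨ ⊕-cong (⊗-congˡ a (partialGen-motzkin k [] [-]))
              (⊕-congʳ [] (≋-trans (partialGen-motzkin k (x ∷ []) (ℕ.n<1+n k ∷ [-]))
                                   (⊗-cong (≡⇒≋ (cong qpow (ℕ.+-identityʳ x))) ≋-refl))) ⟩
  a ⊗ (one ⊗ motzkin k 0) ⊕ (qpow x ⊗ motzkin k 1 ⊕ [])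
    ≈⟨ solve 4 (λ a s M₀ M₁ → a :* (con 1 :* M₀) :+ (s :* M₁ :+ con 0) := con 1 :* (a :* M₀ :+ s :* M₁))
         ≋-refl a (qpow x) (motzkin k 0) (motzkin k 1) ⟩
  one ⊗ motzkin (suc k) 0 ∎
  where
  open ≋-Reasoning
  x = suc k
  a = levelStep x
partialGen-motzkin (suc k) (p ∷ P) linked@(x<p ∷ p∷P-linked) = begin
  partialGen (suc k) (p ∷ P)
    ≈⟨ transfer-step k (p ∷ P) linked ⟩
  a ⊗ partialGen k (p ∷ P) ⊕ (partialGen k (x ∷ p ∷ P) ⊕ qpow (x + p) ⊗ partialGen k P)
    ≈⟨ ⊕-cong (⊗-congˡ a M₁) (⊕-cong M₂ (⊗-congˡ (qpow (x + p)) M₀)) ⟩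
  a ⊗ (qpow (p + S) ⊗ motzkin k (suc h))
    ⊕ (qpow (x + (p + S)) ⊗ motzkin k (2 + h) ⊕ qpow (x + p) ⊗ (u ⊗ motzkin k h))
    ≈⟨ ⊕-cong (⊗-congˡ a (⊗-cong (qpow-+ p S) ≋-refl))
              (⊕-cong (⊗-cong (≋-trans (qpow-+ x (p + S)) (⊗-congˡ s (qpow-+ p S))) ≋-refl)
                      (⊗-cong (qpow-+ x p) ≋-refl)) ⟩
  a ⊗ ((t ⊗ u) ⊗ motzkin k (suc h)) ⊕ ((s ⊗ (t ⊗ u)) ⊗ motzkin k (2 + h) ⊕ (s ⊗ t) ⊗ (u ⊗ motzkin k h))
    ≈⟨ solve 7 (λ a s t u M₀ M₁ M₂ → a :* ((t :* u) :* M₁) :+ ((s :* (t :* u)) :* M₂ :+ (s :* t) :* (u :* M₀))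
                                     := (t :* u) :* (a :* M₁ :+ s :* (M₂ :+ M₀))) ≋-refl
         a s t u (motzkin k h) (motzkin k (suc h)) (motzkin k (2 + h)) ⟩
  (t ⊗ u) ⊗ motzkin (suc k) (suc h)
    ≈⟨ ⊗-cong (qpow-+ p S) ≋-refl ⟨
  qpow (p + S) ⊗ motzkin (suc k) (suc h) ∎
  where
  open ≋-Reasoning
  x = suc k
  a = levelStep x
  s = qpow x
  t = qpow p
  u = qpow (sum P)
  S = sum P
  h = length P
  M₀ = partialGen-motzkin k P (linked-lower (ℕ.<⇒≤ (ℕ.<-trans (ℕ.n<1+n k) x<p)) p∷P-linked)
  M₁ = partialGen-motzkin k (p ∷ P) (linked-lower (ℕ.n≤1+n k) linked)
  M₂ = partialGen-motzkin k (x ∷ p ∷ P) (ℕ.n<1+n k ∷ linked)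

concatMap-↭ : ∀ {A B : Set} (f : A → List B) {xs ys} → xs ↭ ys → concatMap f xs ↭ concatMap f ys
concatMap-↭ f refl         = refl
concatMap-↭ f (prep x σ)   = ↭.++⁺ˡ (f x) (concatMap-↭ f σ)
concatMap-↭ f (swap x y σ) = ↭-trans (↭.++⁺ˡ (f x) (↭.++⁺ˡ (f y) (concatMap-↭ f σ))) (↭.shifts (f x) (f y))
concatMap-↭ f (trans σ τ)  = ↭-trans (concatMap-↭ f σ) (concatMap-↭ f τ)

concatMap-cong-↭ : ∀ {A B : Set} {f g : A → List B} → (∀ x → f x ↭ g x) →
                   ∀ xs → concatMap f xs ↭ concatMap g xs
concatMap-cong-↭ f↭g []       = refl
concatMap-cong-↭ f↭g (x ∷ xs) = ↭.++⁺ (f↭g x) (concatMap-cong-↭ f↭g xs)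

range1-↭ : ∀ m → range1 m ↭ points m
range1-↭ m = ↭.map⁺ suc (↭-trans (↭-sym (↭.↭-reverse (upTo m))) (↭-reflexive (List.reverse-upTo m)))

blocksUpTo-↭ : ∀ m → blocksUpTo m ↭ map ball (points m) ++ concatMap (λ b → arcsTo (b ∸ 1) b) (points m)
blocksUpTo-↭ zero    = refl
blocksUpTo-↭ (suc k) = prep (ball (suc k))
  (↭-trans (↭.++⁺ˡ (arcsTo k (suc k)) (blocksUpTo-↭ k)) (↭.shifts (arcsTo k (suc k)) (map ball (points k))))

allBlocks-↭ : ∀ m → allBlocks m ↭ partialBlocks m []
allBlocks-↭ m = ↭-trans
  (↭.++⁺ (↭.map⁺ ball (range1-↭ m))
         (↭-trans (concatMap-cong-↭ (λ b → ↭.map⁺ (λ a → arc a b) (range1-↭ (b ∸ 1))) (range1 m))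
                  (concatMap-↭ (λ b → arcsTo (b ∸ 1) b) (range1-↭ m))))
  (↭-trans (↭-sym (blocksUpTo-↭ m)) (↭-reflexive (sym (List.++-identityʳ (blocksUpTo m)))))

genX≋motzkin : ∀ m → genX (suc m) ≋ motzkin m 0
genX≋motzkin m = begin
  genX (suc m)
    ≡⟨ cong weight (filterᵇ-cong (λ x → sym (∧-identityʳ (pairwiseOKᵇ x))) (sublists (allBlocks m))) ⟩
  genCover [] (allBlocks m)
    ≈⟨ genCover-↭ (allBlocks-↭ m) [] ⟩
  partialGen m []
    ≈⟨ partialGen-motzkin m [] [-] ⟩
  one ⊗ motzkin m 0
    ≈⟨ ⊗-identityˡ (motzkin m 0) ⟩
  motzkin m 0 ∎
  where open ≋-Reasoning

normaliser : ℕ → Poly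
normaliser m = qint (2 + m) ⊗ (qfact (suc m) ⊗ qfact (suc m))

normaliser-ballot₀ : ∀ m → normaliser m ⊗ ballot m 0 ≋ (qint (2 + m) ⊗ qint (suc m)) ⊗ qfact (suc (m + m))
normaliser-ballot₀ m = begin
  qint (2 + m) ⊗ ((qint (suc m) ⊗ qfact m) ⊗ (qint (suc m) ⊗ qfact m)) ⊗ (one ⊗ b)
    ≈⟨ solve 4 (λ I₂ I₁ f b → I₂ :* ((I₁ :* f) :* (I₁ :* f)) :* (con 1 :* b)
                              := (I₂ :* I₁) :* ((I₁ :* f) :* f :* b)) ≋-refl
         (qint (2 + m)) (qint (suc m)) (qfact m) b ⟩
  (qint (2 + m) ⊗ qint (suc m)) ⊗ (qfact (suc m) ⊗ qfact m ⊗ b)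
    ≈⟨ ⊗-congˡ (qint (2 + m) ⊗ qint (suc m)) (qfact-qbinom (suc m) m) ⟩
  (qint (2 + m) ⊗ qint (suc m)) ⊗ qfact (suc (m + m)) ∎
  where
  open ≋-Reasoning
  b = qbinom (suc (m + m)) (suc m)

normaliser-ballot₁ : ∀ m → normaliser m ⊗ ballot m 1 ≋ (q ⊗ (qint (suc m) ⊗ qint m)) ⊗ qfact (suc (m + m))
normaliser-ballot₁ zero = begin
  normaliser 0 ⊗ (q ⊗ qbinom 1 2)
    ≈⟨ ⊗-congˡ (normaliser 0) (⊗-congˡ q (qbinom-over {1} {2} (s≤s (s≤s z≤n)))) ⟩
  normaliser 0 ⊗ (q ⊗ [])
    ≈⟨ solve 3 (λ c q f → c :* (q :* con 0) := (q :* con 0) :* f) ≋-refl (normaliser 0) q (qfact 1) ⟩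
  (q ⊗ []) ⊗ qfact 1
    ≈⟨ ⊗-cong (⊗-congˡ q (⊗-zeroʳ one)) (≋-refl {qfact 1}) ⟨
  (q ⊗ (one ⊗ [])) ⊗ qfact 1 ∎
  where open ≋-Reasoning
normaliser-ballot₁ (suc m) = begin
  qint (3 + m) ⊗ ((I₁ ⊗ (I₀ ⊗ f)) ⊗ (I₁ ⊗ (I₀ ⊗ f))) ⊗ (q ⊗ b)
    ≈⟨ solve 6 (λ I₂ I₁ I₀ f q b → I₂ :* ((I₁ :* (I₀ :* f)) :* (I₁ :* (I₀ :* f))) :* (q :* b)
                                  := (q :* (I₁ :* I₀)) :* ((I₂ :* (I₁ :* (I₀ :* f))) :* f :* b)) ≋-refl
         (qint (3 + m)) I₁ I₀ f q b ⟩
  (q ⊗ (I₁ ⊗ I₀)) ⊗ (qfact (3 + m) ⊗ qfact m ⊗ b)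
    ≈⟨ ⊗-congˡ (q ⊗ (I₁ ⊗ I₀)) (subst (λ n → qfact (3 + m) ⊗ qfact m ⊗ qbinom n (3 + m) ≋ qfact n)
                                         (cong (2 +_) (sym (ℕ.+-suc m m))) (qfact-qbinom (3 + m) m)) ⟩
  (q ⊗ (I₁ ⊗ I₀)) ⊗ qfact N ∎
  where
  open ≋-Reasoning
  N = suc (suc m + suc m)
  I₁ = qint (2 + m)
  I₀ = qint (suc m)
  f = qfact m
  b = qbinom N (3 + m)

mainTheorem1 : (n : ℕ) → 1 ≤ n →
    (qint (n + 1) ⊗ (qfact n ⊗ qfact n)) ⊗ genX n ≈P qfact (2 * n)
mainTheorem1 (suc m) _ = coeff-≡ (⊕-cancelʳ _ (qfact (2 * suc m)) (C ⊗ ballot m 1) (begin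
  (qint (suc m + 1) ⊗ (qfact (suc m) ⊗ qfact (suc m))) ⊗ genX (suc m) ⊕ C ⊗ ballot m 1
    ≈⟨ ⊕-congʳ (C ⊗ ballot m 1) (⊗-cong (⊗-cong (≡⇒≋ (cong qint (ℕ.+-comm (suc m) 1))) ≋-refl)
                                        (genX≋motzkin m)) ⟩
  C ⊗ motzkin m 0 ⊕ C ⊗ ballot m 1
    ≈⟨ ⊗-distribˡ C (motzkin m 0) (ballot m 1) ⟨
  C ⊗ (motzkin m 0 ⊕ ballot m 1)
    ≈⟨ ⊗-congˡ C (motzkin-ballot m 0) ⟩
  C ⊗ ballot m 0
    ≈⟨ normaliser-ballot₀ m ⟩
  (qint (2 + m) ⊗ qint (suc m)) ⊗ F
    ≈⟨ ⊗-cong (qint-product m) ≋-refl ⟩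
  (qint (suc (suc (m + m))) ⊕ q ⊗ (qint (suc m) ⊗ qint m)) ⊗ F
    ≈⟨ ⊗-distribʳ (qint (suc (suc (m + m)))) (q ⊗ (qint (suc m) ⊗ qint m)) F ⟩
  qfact (suc (suc (m + m))) ⊕ (q ⊗ (qint (suc m) ⊗ qint m)) ⊗ F
    ≈⟨ ⊕-cong (≡⇒≋ (cong qfact (2+[m+m]≡2*[1+m] m))) (≋-sym (normaliser-ballot₁ m)) ⟩
  qfact (2 * suc m) ⊕ C ⊗ ballot m 1 ∎))
  where
  open ≋-Reasoning
  C = normaliser m
  F = qfact (suc (m + m))
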